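{- Let $(A,B)$ be a clean optimal pair and let $(A',B')$ be a redistribution of $(A,B)$. Then (a) $\chi(M_{A'})$ or $\chi(M_{B'})$ is an optimal (integral) vertex of $P(k)$, or (b) one of the pairs $(A,B')$, $(A,A')$, $(A',B)$, $(B',B)$ is a clean optimal pair.
   Context: Instance: finite sets $I$ (suppliers), $J$ (customers) with $|I|=|J|$, numbers $0\le b_i\le c_i$ ($i\in I$), demands $d_j\ge 0$ ($j\in J$), integer $k\in\{0,\dots,|I|\}$. Let $G$ be the bipartite multigraph on $I\cup J$ with, for each $(i,j)$, a red edge of cost $b_id_j$ and a blue edge of cost $c_id_j$; a perfect matching upgrades the suppliers incident to its red edges. For $X\subseteq I$, $\mathrm{cost}(X)$ is the minimum cost of a perfect matching upgrading exactly $X$ and $M_X$ is a fixed such minimum-cost matching. For a perfect matching $M$, $\chi(M)=(x,y)$ with $x_{i,j}=1$ iff red edge $(i,j)\in M$, $y_{i,j}=1$ iff blue edge $(i,j)\in M$, all other entries $0$. $P(k)$ is the set of $(x,y)\in\mathbb{R}_{\ge0}^{I\times J}\times\mathbb{R}_{\ge0}^{I\times J}$ with $\sum_{i}(x_{i,j}+y_{i,j})=1$ for all $j$, $\sum_j(x_{i,j}+y_{i,j})=1$ for all $i$, $\sum_{i,j}x_{i,j}\le k$; the LP minimizes $\sum_{i,j} b_id_jx_{i,j}+c_id_jy_{i,j}$ over $P(k)$, and an optimal vertex is a vertex of $P(k)$ attaining the LP optimum. A pair $(A,B)$ of subsets of $I$ is an optimal pair if $|A|<k<|B|$ and the LP optimum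 equals $f_{A,B}(k):=\frac{|B|-k}{|B|-|A|}\mathrm{cost}(A)+\frac{k-|A|}{|B|-|A|}\mathrm{cost}(B)$. $(A,B)$ is clean if $A\triangle B$ contains no two suppliers $i,i'$ with $b_i<b_{i'}$ and $c_{i'}<c_i$; then $A\triangle B$ can be listed as $i_1,\dots,i_\ell$ with $b_{i_1}\le\dots\le b_{i_\ell}$ and $c_{i_1}\le\dots\le c_{i_\ell}$, and for such a listing the pair $A':=(A\cap B)\cup\{i_{2s}:1\le s\le\lfloor\ell/2\rfloor\}$, $B':=(A\cap B)\cup\{i_{2s-1}:1\le s\le\lceil\ell/2\rceil\}$ is a redistribution of $(A,B)$.
   Formalization: The numbers $b_i$, $c_i$ and $d_j$ are rational, and $P(k)$, its vertices and the LP optimum are taken over rational points instead of real ones. -}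

module Defs where

open import Data.Nat as ℕ using (ℕ; zero; suc)
import Data.Nat.Properties as ℕP
open import Data.Integer using (+_)
open import Data.Rational using (ℚ; 0ℚ; 1ℚ; _+_; _*_; _-_; _≤_; _<_; _/_)
open import Data.Fin using (Fin; zero; suc; _≟_; toℕ) renaming (_≤_ to _≤ᶠ_)
open import Data.Fin.Subset using (Subset; _∈_; _∉_; _∩_; _∪_; ∣_∣)
open import Data.Fin.Permutation using (Permutation′; _⟨$⟩ʳ_)
open import Data.Vec using (lookup)
open import Data.Bool using (Bool; true; false; if_then_else_; _∧_)
open import Data.Product using (Σ; ∃; _×_; _,_)
open import Data.Sum using (_⊎_)
open import Function using (Injective)
open import Data.Empty using (⊥)
open import Data.Nat using (_%_)
open import Relation.Binary.PropositionalEquality using (_≡_)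
open import Relation.Nullary.Decidable using (⌊_⌋)

Σᶠ : ∀ {n} → (Fin n → ℚ) → ℚ
Σᶠ {zero}  f = 0ℚ
Σᶠ {suc n} f = f zero + Σᶠ (λ i → f (suc i))

ℕ→ℚ : ℕ → ℚ
ℕ→ℚ m = + m / 1

-- An instance: I = J = Fin n, data b, c, d with 0 ≤ b i ≤ c i, d j ≥ 0,
-- and an integer k ∈ {0,…,n}.

record Instance (n : ℕ) : Set where
  field
    b  : Fin n → ℚ
    c  : Fin n → ℚ
    d  : Fin n → ℚ
    k  : ℕ
    0≤b : ∀ i → 0ℚ ≤ b i
    b≤c : ∀ i → b i ≤ c i
    0≤d : ∀ j → 0ℚ ≤ d j
    k≤n : k ℕ.≤ n

-- A perfect matching assigns to each supplier i the customer σ i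
-- (σ a bijection I → J) and uses the red edge (i , σ i) if i ∈ red,
-- the blue edge (i , σ i) otherwise.

record Matching (n : ℕ) : Set where
  constructor matching
  field
    σ   : Permutation′ n
    red : Subset n

open Matching public

Upgrades : ∀ {n} → Matching n → Subset n → Set
Upgrades M X = red M ≡ X

module _ {n : ℕ} (inst : Instance n) where
  open Instance inst

  matchingCost : Matching n → ℚ
  matchingCost M =
    Σᶠ (λ i → (if lookup (red M) i then b i else c i) * d (σ M ⟨$⟩ʳ i))

  IsMinMatching : Subset n → Matching n → Set
  IsMinMatching X M =
    Upgrades M X × (∀ M′ → Upgrades M′ X → matchingCost M ≤ matchingCost M′)

-- Points (x , y) ∈ ℚ^{I×J} × ℚ^{I×J}  (x i j, y i j for supplier i,
-- customer j) and the polytope P(k).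

record Point (n : ℕ) : Set where
  constructor point
  field
    x : Fin n → Fin n → ℚ
    y : Fin n → Fin n → ℚ

open Point public

χ : ∀ {n} → Matching n → Point n
χ M = point
  (λ i j → if lookup (red M) i ∧ ⌊ σ M ⟨$⟩ʳ i ≟ j ⌋ then 1ℚ else 0ℚ)
  (λ i j → if lookup (red M) i then 0ℚ else (if ⌊ σ M ⟨$⟩ʳ i ≟ j ⌋ then 1ℚ else 0ℚ))

_≐_ : ∀ {n} → Point n → Point n → Set
p ≐ q = ∀ i j → (x p i j ≡ x q i j) × (y p i j ≡ y q i j)

comb : ∀ {n} → ℚ → Point n → Point n → Point n
comb t p q = point (λ i j → t * x p i j + (1ℚ - t) * x q i j)
                   (λ i j → t * y p i j + (1ℚ - t) * y q i j)

InP : ∀ {n} → ℕ → Point n → Set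
InP k p =
    (∀ i j → 0ℚ ≤ x p i j) × (∀ i j → 0ℚ ≤ y p i j)
  × (∀ j → Σᶠ (λ i → x p i j + y p i j) ≡ 1ℚ)
  × (∀ i → Σᶠ (λ j → x p i j + y p i j) ≡ 1ℚ)
  × (Σᶠ (λ i → Σᶠ (λ j → x p i j)) ≤ ℕ→ℚ k)

IsVertex : ∀ {n} → ℕ → Point n → Set
IsVertex {n} k p =
  InP k p ×
  (∀ (q r : Point n) (t : ℚ) → InP k q → InP k r → 0ℚ < t → t < 1ℚ →
     p ≐ comb t q r → q ≐ r)

module _ {n : ℕ} (inst : Instance n) where
  open Instance inst

  obj : Point n → ℚ
  obj p = Σᶠ (λ i → Σᶠ (λ j → b i * d j * x p i j + c i * d j * y p i j))

  IsLPOptimum : ℚ → Set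
  IsLPOptimum v = (∃ λ p → InP k p × obj p ≡ v) × (∀ p → InP k p → v ≤ obj p)

  IsOptimalVertex : Point n → Set
  IsOptimalVertex p = IsVertex k p × (∀ q → InP k q → obj p ≤ obj q)

  -- Fix a choice M_X of minimum-cost matching for every X ⊆ I;
  -- cost(X) = cost of M_X.
  module WithChoice (M : Subset n → Matching n) where

    cost : Subset n → ℚ
    cost X = matchingCost inst (M X)

    f : (A B : Subset n) → ∣ A ∣ ℕ.< ∣ B ∣ → ℚ
    f A B lt =
      let instance _ = ℕ.>-nonZero (ℕP.m<n⇒0<n∸m lt) in
      ((ℕ→ℚ ∣ B ∣ - ℕ→ℚ k) * cost A + (ℕ→ℚ k - ℕ→ℚ ∣ A ∣) * cost B)
        * (+ 1 / (∣ B ∣ ℕ.∸ ∣ A ∣))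

    IsOptimalPair : Subset n → Subset n → Set
    IsOptimalPair A B =
      Σ (∣ A ∣ ℕ.< k) λ Ak → Σ (k ℕ.< ∣ B ∣) λ kB →
        IsLPOptimum (f A B (ℕP.<-trans Ak kB))

  _∈△_,_ : Fin n → Subset n → Subset n → Set
  i ∈△ A , B = (i ∈ A × i ∉ B) ⊎ (i ∉ A × i ∈ B)

  IsClean : Subset n → Subset n → Set
  IsClean A B = ∀ i i′ → i ∈△ A , B → i′ ∈△ A , B →
    b i < b i′ → c i′ < c i → ⊥

  -- (A′ , B′) is a redistribution of (A , B): there is a listing
  -- i_1,…,i_ℓ of A △ B (here indexed 0,…,ℓ-1 by Fin ℓ) non-decreasing
  -- in both b and c, with A′ = (A ∩ B) ∪ {i_{2s}} and
  -- B′ = (A ∩ B) ∪ {i_{2s-1}}.  In 0-based indexing, i_{2s} has odd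
  -- index and i_{2s-1} has even index.
  IsRedistribution : (A B A′ B′ : Subset n) → Set
  IsRedistribution A B A′ B′ =
    Σ ℕ λ ℓ → Σ (Fin ℓ → Fin n) λ lst →
        Injective _≡_ _≡_ lst
      × (∀ i → i ∈△ A , B → ∃ λ t → lst t ≡ i)
      × (∀ t → lst t ∈△ A , B)
      × (∀ s t → s ≤ᶠ t → b (lst s) ≤ b (lst t))
      × (∀ s t → s ≤ᶠ t → c (lst s) ≤ c (lst t))
      × (∀ i → i ∈ A′ → i ∈ (A ∩ B) ⊎ (∃ λ t → lst t ≡ i × toℕ t % 2 ≡ 1))
      × (∀ i → i ∈ (A ∩ B) ⊎ (∃ λ t → lst t ≡ i × toℕ t % 2 ≡ 1) → i ∈ A′)
      × (∀ i → i ∈ B′ → i ∈ (A ∩ B) ⊎ (∃ λ t → lst t ≡ i × toℕ t % 2 ≡ 0))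
      × (∀ i → i ∈ (A ∩ B) ⊎ (∃ λ t → lst t ≡ i × toℕ t % 2 ≡ 0) → i ∈ B′)

{-# OPTIONS --safe #-}
-- A cheapest matching upgrading X has no crossing pair, so the number of suppliers whose weight (b i if
-- upgraded, c i otherwise) is at least θ and whose customer's demand is at least η is
-- (#{weights ≥ θ} + #{demands ≥ η} - n)⁺. Comparing Σ x y through these two-dimensional level counts
-- (peeling off the least positive value) gives cost A′ + cost B′ ≤ cost A + cost B: a redistribution
-- keeps the sum of the level counts of the two sides and makes them differ by at most one (for each θ
-- the suppliers with b i < θ ≤ c i form an interval of the sorted listing of A △ B, which is shared out
-- alternately), and a ↦ (a - n)⁺ is convex. As |A′| + |B′| = |A| + |B|, one X ∈ {A′ , B′} lies below
-- the chord through (|A| , cost A) and (|B| , cost B), whose value at k is the LP optimum. According as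
-- |X| < k, |X| = k or |X| > k, the pair (X , B), the vertex χ (M X) or the pair (A , X) attains it; both
-- pairs are clean because their symmetric differences lie in A △ B.
module Submission where

open import Defs

open import Algebra.Bundles using (CommutativeMonoid)
import Algebra.Properties.CommutativeMonoid.Sum as Summation
import Algebra.Properties.CommutativeSemigroup as CommutativeSemigroupProperties
open import Data.Bool using (Bool; true; false; if_then_else_; _∧_; _∨_; not; _xor_)
import Data.Bool.Properties as BoolP
open import Data.Empty using (⊥; ⊥-elim)
open import Data.Fin as Fin using (Fin; zero; suc; _≟_; toℕ; _↑ˡ_; _↑ʳ_) renaming (_≤_ to _≤ᶠ_)
import Data.Fin.Properties as FinP
open import Data.Fin.Permutation as Perm using (Permutation′; _⟨$⟩ʳ_; _∘ₚ_)
import Data.Fin.Permutation.Components as PermC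
open import Data.Fin.Subset using (Subset; _∈_; _∉_; _∩_; ∣_∣)
import Data.Integer as ℤ
open import Data.Integer.Solver using () renaming (module +-*-Solver to ℤ-Solver)
open import Data.Nat as ℕ using (ℕ; zero; suc; z≤n; s≤s; _%_)
import Data.Nat.Properties as ℕP
open import Data.Nat.Solver using () renaming (module +-*-Solver to ℕ-Solver)
open import Data.Product using (∃; _×_; _,_; proj₁; proj₂)
open import Data.Rational using (ℚ; 0ℚ; 1ℚ; _+_; _*_; _-_; -_; _≤_; _<_; _/_; toℚᵘ; positive; nonNegative)
import Data.Rational.Properties as ℚP
open import Data.Rational.Solver using () renaming (module +-*-Solver to ℚ-Solver)
import Data.Rational.Unnormalised as ℚᵘ
import Data.Rational.Unnormalised.Properties as ℚᵘP
open import Data.Sum using (_⊎_; inj₁; inj₂; [_,_]′) renaming (map to ⊎-map)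
open import Data.Vec using ([]; _∷_; lookup)
import Data.Vec.Properties as VecP
open import Data.Vec.Functional using (_++_; updateAt)
import Data.Vec.Functional.Properties as VecFP
open import Function using (_∘_; id; Injective)
open import Level using (0ℓ)
open import Relation.Binary.Definitions using (Tri; tri<; tri≈; tri>)
open import Relation.Binary.PropositionalEquality
  using (_≡_; _≢_; refl; sym; trans; cong; cong₂; subst; subst₂; module ≡-Reasoning)
open import Relation.Nullary using (¬_; Dec; yes; no; does; contradiction)
open import Relation.Nullary.Decidable using (dec-true; dec-false; ⌊_⌋)

<⇒≱ : ∀ {p q} → p < q → ¬ q ≤ p
<⇒≱ p<q q≤p = ℚP.<-irrefl refl (ℚP.<-≤-trans p<q q≤p)

p≤p+q : ∀ {p q} → 0ℚ ≤ q → p ≤ p + q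
p≤p+q {p} {q} q≥0 = subst (_≤ p + q) (ℚP.+-identityʳ p) (ℚP.+-monoʳ-≤ p q≥0)

p<p+q : ∀ {p q} → 0ℚ < q → p < p + q
p<p+q {p} {q} q>0 = subst (_< p + q) (ℚP.+-identityʳ p) (ℚP.+-monoʳ-< p q>0)

p≤q⇒0≤q-p : ∀ {p q} → p ≤ q → 0ℚ ≤ q - p
p≤q⇒0≤q-p {p} {q} p≤q = subst (_≤ q - p) (ℚP.+-inverseʳ p) (ℚP.+-monoˡ-≤ (- p) p≤q)

p<q⇒0<q-p : ∀ {p q} → p < q → 0ℚ < q - p
p<q⇒0<q-p {p} {q} p<q = subst (_< q - p) (ℚP.+-inverseʳ p) (ℚP.+-monoˡ-< (- p) p<q)

*-nonNeg : ∀ {p q} → 0ℚ ≤ p → 0ℚ ≤ q → 0ℚ ≤ p * q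
*-nonNeg {p} {q} p≥0 q≥0 = ℚP.nonNegative⁻¹ (p * q)
  {{ℚP.nonNeg*nonNeg⇒nonNeg p {{nonNegative p≥0}} q {{nonNegative q≥0}}}}

*-pos : ∀ {p q} → 0ℚ < p → 0ℚ < q → 0ℚ < p * q
*-pos {p} {q} p>0 q>0 = ℚP.positive⁻¹ (p * q) {{ℚP.pos*pos⇒pos p {{positive p>0}} q {{positive q>0}}}}

*-monoˡ-≤-0≤ : ∀ {r p q} → 0ℚ ≤ r → p ≤ q → r * p ≤ r * q
*-monoˡ-≤-0≤ {r} r≥0 = ℚP.*-monoˡ-≤-nonNeg r {{nonNegative r≥0}}

*-monoʳ-≤-0≤ : ∀ {r p q} → 0ℚ ≤ r → p ≤ q → p * r ≤ q * r
*-monoʳ-≤-0≤ {r} r≥0 = ℚP.*-monoʳ-≤-nonNeg r {{nonNegative r≥0}}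

nonNeg-cases : ∀ {p} → 0ℚ ≤ p → p ≡ 0ℚ ⊎ 0ℚ < p
nonNeg-cases {p} p≥0 with 0ℚ ℚP.<? p
... | yes p>0 = inj₂ p>0
... | no  p≯0 = inj₁ (ℚP.≤-antisym (ℚP.≮⇒≥ p≯0) p≥0)

-- ℕ→ℚ m normalises through a gcd that does not compute for a variable m, so we calculate in ℚᵘ.
toℚᵘ-ℕ→ℚ : ∀ m → toℚᵘ (ℕ→ℚ m) ℚᵘ.≃ ℚᵘ.mkℚᵘ (ℤ.+ m) 0
toℚᵘ-ℕ→ℚ m = ℚP.toℚᵘ-fromℚᵘ (ℚᵘ.mkℚᵘ (ℤ.+ m) 0)

ℕ→ℚ-+ : ∀ a b → ℕ→ℚ (a ℕ.+ b) ≡ ℕ→ℚ a + ℕ→ℚ b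
ℕ→ℚ-+ a b = ℚP.toℚᵘ-injective (ℚᵘP.≃-trans (toℚᵘ-ℕ→ℚ (a ℕ.+ b)) (ℚᵘP.≃-trans (ℚᵘ.*≡* eq)
  (ℚᵘP.≃-sym (ℚᵘP.≃-trans (ℚP.toℚᵘ-homo-+ (ℕ→ℚ a) (ℕ→ℚ b)) (ℚᵘP.+-cong (toℚᵘ-ℕ→ℚ a) (toℚᵘ-ℕ→ℚ b))))))
  where
  open ℤ-Solver
  eq : (ℤ.+ a ℤ.+ ℤ.+ b) ℤ.* ℤ.+ 1 ≡ (ℤ.+ a ℤ.* ℤ.+ 1 ℤ.+ ℤ.+ b ℤ.* ℤ.+ 1) ℤ.* ℤ.+ 1
  eq = solve 2 (λ a b → (a :+ b) :* con (ℤ.+ 1) := (a :* con (ℤ.+ 1) :+ b :* con (ℤ.+ 1)) :* con (ℤ.+ 1))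
    refl (ℤ.+ a) (ℤ.+ b)

ℕ→ℚ-nonNeg : ∀ m → 0ℚ ≤ ℕ→ℚ m
ℕ→ℚ-nonNeg m = ℚP.nonNegative⁻¹ (ℕ→ℚ m) {{ℚP.normalize-nonNeg m 1}}

ℕ→ℚ-mono-≤ : ∀ {a b} → a ℕ.≤ b → ℕ→ℚ a ≤ ℕ→ℚ b
ℕ→ℚ-mono-≤ {a} {b} a≤b = subst (ℕ→ℚ a ≤_)
  (trans (sym (ℕ→ℚ-+ a (b ℕ.∸ a))) (cong ℕ→ℚ (ℕP.m+[n∸m]≡n a≤b))) (p≤p+q (ℕ→ℚ-nonNeg (b ℕ.∸ a)))

ℕ→ℚ-∸ : ∀ {a b} → b ℕ.≤ a → ℕ→ℚ (a ℕ.∸ b) ≡ ℕ→ℚ a - ℕ→ℚ b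
ℕ→ℚ-∸ {a} {b} b≤a = begin
  ℕ→ℚ (a ℕ.∸ b)                   ≡⟨ solve 2 (λ x y → x := (x :+ y) :- y) refl (ℕ→ℚ (a ℕ.∸ b)) (ℕ→ℚ b) ⟩
  ℕ→ℚ (a ℕ.∸ b) + ℕ→ℚ b - ℕ→ℚ b  ≡⟨ cong (_- ℕ→ℚ b) (sym (ℕ→ℚ-+ (a ℕ.∸ b) b)) ⟩
  ℕ→ℚ (a ℕ.∸ b ℕ.+ b) - ℕ→ℚ b    ≡⟨ cong (λ z → ℕ→ℚ z - ℕ→ℚ b) (ℕP.m∸n+n≡m b≤a) ⟩
  ℕ→ℚ a - ℕ→ℚ b                   ∎
  where
  open ≡-Reasoning
  open ℚ-Solver

1/n*n≡1 : ∀ n .{{_ : ℕ.NonZero n}} → (ℤ.+ 1 / n) * ℕ→ℚ n ≡ 1ℚ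
1/n*n≡1 (suc n) = ℚP.toℚᵘ-injective (ℚᵘP.≃-trans (ℚP.toℚᵘ-homo-* (ℤ.+ 1 / suc n) (ℕ→ℚ (suc n)))
  (ℚᵘP.≃-trans (ℚᵘP.*-cong (ℚP.toℚᵘ-fromℚᵘ (ℚᵘ.mkℚᵘ (ℤ.+ 1) n)) (toℚᵘ-ℕ→ℚ (suc n))) (ℚᵘ.*≡* eq)))
  where
  open ℤ-Solver
  eq : (ℤ.+ 1 ℤ.* ℤ.+ suc n) ℤ.* ℤ.+ 1 ≡ ℤ.+ 1 ℤ.* (ℤ.+ suc n ℤ.* ℤ.+ 1)
  eq = solve 1 (λ m → (con (ℤ.+ 1) :* m) :* con (ℤ.+ 1) := con (ℤ.+ 1) :* (m :* con (ℤ.+ 1))) refl (ℤ.+ suc n)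

0≤1/n : ∀ n .{{_ : ℕ.NonZero n}} → 0ℚ ≤ ℤ.+ 1 / n
0≤1/n n = ℚP.nonNegative⁻¹ (ℤ.+ 1 / n) {{ℚP.normalize-nonNeg 1 n}}

-p+[p+q]≡q : ∀ p q → - p + (p + q) ≡ q
-p+[p+q]≡q p q = solve 2 (λ p q → :- p :+ (p :+ q) := q) refl p q
  where open ℚ-Solver

+-cancelˡ-≤ : ∀ r {p q} → r + p ≤ r + q → p ≤ q
+-cancelˡ-≤ r {p} {q} r+p≤r+q = subst₂ _≤_ (-p+[p+q]≡q r p) (-p+[p+q]≡q r q) (ℚP.+-monoʳ-≤ (- r) r+p≤r+q)

+-cancelˡ-< : ∀ r {p q} → r + p < r + q → p < q
+-cancelˡ-< r {p} {q} r+p<r+q = subst₂ _<_ (-p+[p+q]≡q r p) (-p+[p+q]≡q r q) (ℚP.+-monoʳ-< (- r) r+p<r+q)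

rearrangement-< : ∀ {a a′ b b′} → a′ < a → b′ < b → a * b′ + a′ * b < a * b + a′ * b′
rearrangement-< {a} {a′} {b} {b′} a′<a b′<b =
  subst₂ _<_ (ℚP.+-identityʳ (a * b′ + a′ * b))
    (solve 4 (λ a a′ b b′ → a :* b′ :+ a′ :* b :+ (a :- a′) :* (b :- b′) := a :* b :+ a′ :* b′) refl a a′ b b′)
    (ℚP.+-monoʳ-< (a * b′ + a′ * b) (*-pos (p<q⇒0<q-p a′<a) (p<q⇒0<q-p b′<b)))
  where open ℚ-Solver

+-split-≤ : ∀ {a b c d} → a + b ≤ c + d → a ≤ c ⊎ b ≤ d
+-split-≤ {a} {b} {c} {d} a+b≤c+d with a ℚP.≤? c
... | yes a≤c = inj₁ a≤c
... | no  a≰c = inj₂ (ℚP.<⇒≤ (+-cancelˡ-< a (ℚP.≤-<-trans a+b≤c+d (ℚP.+-monoˡ-< d (ℚP.≰⇒> a≰c)))))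

module _ (M : CommutativeMonoid 0ℓ 0ℓ) where
  open CommutativeMonoid M
    using (Carrier; _≈_; _∙_; ε; ∙-congˡ; identityˡ; assoc; commutativeSemigroup; setoid)
    renaming (sym to ≈-sym; trans to ≈-trans)
  open Summation M using (sum)
  open CommutativeSemigroupProperties commutativeSemigroup using (x∙yz≈y∙xz)
  open import Relation.Binary.Reasoning.Setoid setoid

  sum-erase : ∀ {n} (h : Fin n → Carrier) a → sum h ≈ h a ∙ sum (updateAt h a (λ _ → ε))
  sum-erase {suc n} h zero    = ∙-congˡ (≈-sym (identityˡ _))
  sum-erase {suc n} h (suc a) = begin
    h zero ∙ sum (h ∘ suc)                                       ≈⟨ ∙-congˡ (sum-erase (h ∘ suc) a) ⟩
    h zero ∙ (h (suc a) ∙ sum (updateAt (h ∘ suc) a (λ _ → ε)))  ≈⟨ x∙yz≈y∙xz _ _ _ ⟩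
    h (suc a) ∙ (h zero ∙ sum (updateAt (h ∘ suc) a (λ _ → ε)))  ∎

  sum-↑ : ∀ {m n} (h : Fin (m ℕ.+ n) → Carrier) → sum h ≈ sum (λ i → h (i ↑ˡ n)) ∙ sum (λ j → h (m ↑ʳ j))
  sum-↑ {zero}      h = ≈-sym (identityˡ _)
  sum-↑ {suc m} {n} h = ≈-trans (∙-congˡ (sum-↑ {m} (h ∘ suc))) (≈-sym (assoc _ _ _))

module ℕΣ = Summation ℕP.+-0-commutativeMonoid
module ℚΣ = Summation ℚP.+-0-commutativeMonoid

Σᶠ≡sum : ∀ {n} (f : Fin n → ℚ) → Σᶠ f ≡ ℚΣ.sum f
Σᶠ≡sum {zero}  f = refl
Σᶠ≡sum {suc n} f = cong (f zero +_) (Σᶠ≡sum (f ∘ suc))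

Σᶠ-cong : ∀ {n} {f g : Fin n → ℚ} → (∀ i → f i ≡ g i) → Σᶠ f ≡ Σᶠ g
Σᶠ-cong {zero}  f≗g = refl
Σᶠ-cong {suc n} f≗g = cong₂ _+_ (f≗g zero) (Σᶠ-cong (f≗g ∘ suc))

Σᶠ-zero : ∀ {n} {f : Fin n → ℚ} → (∀ i → f i ≡ 0ℚ) → Σᶠ f ≡ 0ℚ
Σᶠ-zero {zero}  f≗0 = refl
Σᶠ-zero {suc n} f≗0 = cong₂ _+_ (f≗0 zero) (Σᶠ-zero (f≗0 ∘ suc))

Σᶠ-distrib-+ : ∀ {n} (f g : Fin n → ℚ) → Σᶠ (λ i → f i + g i) ≡ Σᶠ f + Σᶠ g
Σᶠ-distrib-+ f g = trans (Σᶠ≡sum (λ i → f i + g i))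
  (trans (ℚΣ.∑-distrib-+ f g) (sym (cong₂ _+_ (Σᶠ≡sum f) (Σᶠ≡sum g))))

Σᶠ-distribˡ-* : ∀ {n} (c : ℚ) (f : Fin n → ℚ) → Σᶠ (λ i → c * f i) ≡ c * Σᶠ f
Σᶠ-distribˡ-* {zero}  c f = sym (ℚP.*-zeroʳ c)
Σᶠ-distribˡ-* {suc n} c f =
  trans (cong (c * f zero +_) (Σᶠ-distribˡ-* c (f ∘ suc))) (sym (ℚP.*-distribˡ-+ c (f zero) (Σᶠ (f ∘ suc))))

Σᶠ-linear : ∀ {n} (s t : ℚ) (f g : Fin n → ℚ) → Σᶠ (λ i → s * f i + t * g i) ≡ s * Σᶠ f + t * Σᶠ g
Σᶠ-linear s t f g =
  trans (Σᶠ-distrib-+ (λ i → s * f i) (λ i → t * g i)) (cong₂ _+_ (Σᶠ-distribˡ-* s f) (Σᶠ-distribˡ-* t g))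

Σᶠ-mono-≤ : ∀ {n} {f g : Fin n → ℚ} → (∀ i → f i ≤ g i) → Σᶠ f ≤ Σᶠ g
Σᶠ-mono-≤ {zero}  f≤g = ℚP.≤-refl
Σᶠ-mono-≤ {suc n} f≤g = ℚP.+-mono-≤ (f≤g zero) (Σᶠ-mono-≤ (f≤g ∘ suc))

Σᶠ-nonNeg : ∀ {n} {f : Fin n → ℚ} → (∀ i → 0ℚ ≤ f i) → 0ℚ ≤ Σᶠ f
Σᶠ-nonNeg {n} {f} f≥0 = subst (_≤ Σᶠ f) (Σᶠ-zero {n} {λ _ → 0ℚ} (λ _ → refl)) (Σᶠ-mono-≤ f≥0)

Σᶠ-permute : ∀ {n} (f : Fin n → ℚ) (π : Permutation′ n) → Σᶠ f ≡ Σᶠ (λ i → f (π ⟨$⟩ʳ i))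
Σᶠ-permute f π = trans (Σᶠ≡sum f) (trans (ℚΣ.sum-permute f π) (sym (Σᶠ≡sum (λ i → f (π ⟨$⟩ʳ i)))))

Σᶠ-↑ : ∀ {m n} (h : Fin (m ℕ.+ n) → ℚ) → Σᶠ h ≡ Σᶠ (λ i → h (i ↑ˡ n)) + Σᶠ (λ j → h (m ↑ʳ j))
Σᶠ-↑ {m} {n} h = trans (Σᶠ≡sum h) (trans (sum-↑ ℚP.+-0-commutativeMonoid {m} h)
  (sym (cong₂ _+_ (Σᶠ≡sum (λ i → h (i ↑ˡ n))) (Σᶠ≡sum (λ j → h (m ↑ʳ j))))))

Σᶠ-erase : ∀ {n} (h : Fin n → ℚ) a → Σᶠ h ≡ h a + Σᶠ (updateAt h a (λ _ → 0ℚ))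
Σᶠ-erase h a = trans (Σᶠ≡sum h) (trans (sum-erase ℚP.+-0-commutativeMonoid h a)
  (cong (h a +_) (sym (Σᶠ≡sum (updateAt h a (λ _ → 0ℚ))))))

Σᶠ-single : ∀ {n} (h : Fin n → ℚ) a → (∀ j → j ≢ a → h j ≡ 0ℚ) → Σᶠ h ≡ h a
Σᶠ-single h a h≡0 = trans (Σᶠ-erase h a) (trans (cong (h a +_) (Σᶠ-zero erased≡0)) (ℚP.+-identityʳ (h a)))
  where
  erased≡0 : ∀ j → updateAt h a (λ _ → 0ℚ) j ≡ 0ℚ
  erased≡0 j with j ≟ a
  ... | yes refl = VecFP.updateAt-updates j h
  ... | no  j≢a  = trans (VecFP.updateAt-minimal j a h j≢a) (h≡0 j j≢a)

Σᶠ-term : ∀ {n} (h : Fin n → ℚ) → (∀ j → 0ℚ ≤ h j) → ∀ a → h a ≤ Σᶠ h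
Σᶠ-term h h≥0 a = subst (h a ≤_) (sym (Σᶠ-erase h a)) (p≤p+q (Σᶠ-nonNeg erased≥0))
  where
  erased≥0 : ∀ j → 0ℚ ≤ updateAt h a (λ _ → 0ℚ) j
  erased≥0 j with j ≟ a
  ... | yes refl = ℚP.≤-reflexive (sym (VecFP.updateAt-updates j h))
  ... | no  j≢a  = subst (0ℚ ≤_) (sym (VecFP.updateAt-minimal j a h j≢a)) (h≥0 j)

Σᶠ-exchange : ∀ {n} (g h : Fin n → ℚ) {i x : Fin n} → i ≢ x → (∀ j → j ≢ i → j ≢ x → g j ≡ h j) →
  Σᶠ g + (h i + h x) ≡ Σᶠ h + (g i + g x)
Σᶠ-exchange g h {i} {x} i≢x g≗h = begin
  Σᶠ g + (h i + h x)                      ≡⟨ cong (_+ (h i + h x)) (split g) ⟩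
  g i + (g x + Σᶠ (rest g)) + (h i + h x) ≡⟨ shuffle (g i) (g x) (Σᶠ (rest g)) (h i) (h x) ⟩
  h i + (h x + Σᶠ (rest g)) + (g i + g x) ≡⟨ cong (λ r → h i + (h x + r) + (g i + g x)) (Σᶠ-cong rest-agree) ⟩
  h i + (h x + Σᶠ (rest h)) + (g i + g x) ≡⟨ cong (_+ (g i + g x)) (sym (split h)) ⟩
  Σᶠ h + (g i + g x)                      ∎
  where
  open ≡-Reasoning
  open ℚ-Solver
  shuffle : ∀ a b r c d → a + (b + r) + (c + d) ≡ c + (d + r) + (a + b)
  shuffle = solve 5 (λ a b r c d → a :+ (b :+ r) :+ (c :+ d) := c :+ (d :+ r) :+ (a :+ b)) refl
  rest : (Fin _ → ℚ) → Fin _ → ℚ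
  rest f = updateAt (updateAt f i (λ _ → 0ℚ)) x (λ _ → 0ℚ)
  split : ∀ f → Σᶠ f ≡ f i + (f x + Σᶠ (rest f))
  split f = trans (Σᶠ-erase f i) (cong (f i +_) (trans (Σᶠ-erase (updateAt f i (λ _ → 0ℚ)) x)
    (cong (_+ Σᶠ (rest f)) (VecFP.updateAt-minimal x i f (i≢x ∘ sym)))))
  rest-agree : ∀ j → rest g j ≡ rest h j
  rest-agree j with j ≟ x | j ≟ i
  ... | yes refl | _        = trans (VecFP.updateAt-updates j _) (sym (VecFP.updateAt-updates j _))
  ... | no  j≢x  | yes refl = trans (VecFP.updateAt-minimal j x _ j≢x) (trans (VecFP.updateAt-updates j g)
                                (sym (trans (VecFP.updateAt-minimal j x _ j≢x) (VecFP.updateAt-updates j h))))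
  ... | no  j≢x  | no  j≢i  = trans (VecFP.updateAt-minimal j x _ j≢x) (trans (VecFP.updateAt-minimal j i g j≢i)
                                (trans (g≗h j j≢i j≢x)
                                (sym (trans (VecFP.updateAt-minimal j x _ j≢x) (VecFP.updateAt-minimal j i h j≢i)))))

𝟙 : Bool → ℕ
𝟙 b = if b then 1 else 0

count : ∀ {N} → (Fin N → Bool) → ℕ
count p = ℕΣ.sum (λ k → 𝟙 (p k))

count-cong : ∀ {N} {p q : Fin N → Bool} → (∀ k → p k ≡ q k) → count p ≡ count q
count-cong p≗q = ℕΣ.sum-cong-≗ (cong 𝟙 ∘ p≗q)

count-+-cong : ∀ {N} {p q p′ q′ : Fin N → Bool} → (∀ k → 𝟙 (p k) ℕ.+ 𝟙 (q k) ≡ 𝟙 (p′ k) ℕ.+ 𝟙 (q′ k)) →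
  count p ℕ.+ count q ≡ count p′ ℕ.+ count q′
count-+-cong {p = p} {q} {p′} {q′} eq = trans (sym (ℕΣ.∑-distrib-+ (𝟙 ∘ p) (𝟙 ∘ q)))
  (trans (ℕΣ.sum-cong-≗ eq) (ℕΣ.∑-distrib-+ (𝟙 ∘ p′) (𝟙 ∘ q′)))

count-∧-∨ : ∀ {N} (p q : Fin N → Bool) → count p ℕ.+ count q ≡ count (λ k → p k ∧ q k) ℕ.+ count (λ k → p k ∨ q k)
count-∧-∨ p q = count-+-cong (λ k → 𝟙-∧-∨ (p k) (q k))
  where
  𝟙-∧-∨ : ∀ a b → 𝟙 a ℕ.+ 𝟙 b ≡ 𝟙 (a ∧ b) ℕ.+ 𝟙 (a ∨ b)
  𝟙-∧-∨ true  b     = ℕP.+-comm 1 (𝟙 b)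
  𝟙-∧-∨ false true  = refl
  𝟙-∧-∨ false false = refl

𝟙-mono : ∀ {a b} → (a ≡ true → b ≡ true) → 𝟙 a ℕ.≤ 𝟙 b
𝟙-mono {false} a⇒b = z≤n
𝟙-mono {true}  a⇒b rewrite a⇒b refl = ℕP.≤-refl

count-mono : ∀ {N} {p q : Fin N → Bool} → (∀ k → p k ≡ true → q k ≡ true) → count p ℕ.≤ count q
count-mono {zero}  p⇒q = z≤n
count-mono {suc N} p⇒q = ℕP.+-mono-≤ (𝟙-mono (p⇒q zero)) (count-mono (p⇒q ∘ suc))

count-mono-< : ∀ {N} {p q : Fin N → Bool} → (∀ k → p k ≡ true → q k ≡ true) →
  ∀ k → p k ≡ false → q k ≡ true → count p ℕ.< count q
count-mono-< {suc N} p⇒q zero    pk qk rewrite pk | qk = s≤s (count-mono (p⇒q ∘ suc))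
count-mono-< {suc N} p⇒q (suc k) pk qk =
  ℕP.+-mono-≤-< (𝟙-mono (p⇒q zero)) (count-mono-< (p⇒q ∘ suc) k pk qk)

count≤N : ∀ {N} (p : Fin N → Bool) → count p ℕ.≤ N
count≤N {zero}  p = z≤n
count≤N {suc N} p = ℕP.+-mono-≤ (𝟙≤1 (p zero)) (count≤N (p ∘ suc))
  where
  𝟙≤1 : ∀ b → 𝟙 b ℕ.≤ 1
  𝟙≤1 true  = ℕP.≤-refl
  𝟙≤1 false = z≤n

count-all : ∀ {N} {p : Fin N → Bool} → (∀ k → p k ≡ true) → count p ≡ N
count-all {zero}  p≡true = refl
count-all {suc N} p≡true rewrite p≡true zero = cong suc (count-all (p≡true ∘ suc))

count-none : ∀ {N} {p : Fin N → Bool} → (∀ k → p k ≡ false) → count p ≡ 0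
count-none {zero}  p≡false = refl
count-none {suc N} p≡false rewrite p≡false zero = count-none (p≡false ∘ suc)

count-permute : ∀ {N} (p : Fin N → Bool) (π : Permutation′ N) → count p ≡ count (λ k → p (π ⟨$⟩ʳ k))
count-permute p π = ℕΣ.sum-permute (𝟙 ∘ p) π

∣∣≡count : ∀ {n} (X : Subset n) → ∣ X ∣ ≡ count (lookup X)
∣∣≡count []          = refl
∣∣≡count (true ∷ X)  = cong suc (∣∣≡count X)
∣∣≡count (false ∷ X) = ∣∣≡count X

Σᶠ-𝟙 : ∀ {N} (p : Fin N → Bool) → Σᶠ (λ k → ℕ→ℚ (𝟙 (p k))) ≡ ℕ→ℚ (count p)
Σᶠ-𝟙 {zero}  p = refl
Σᶠ-𝟙 {suc N} p = trans (cong (ℕ→ℚ (𝟙 (p zero)) +_) (Σᶠ-𝟙 (p ∘ suc))) (sym (ℕ→ℚ-+ (𝟙 (p zero)) _))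

count-∧-none : ∀ {ℓ} (P T : Fin ℓ → Bool) → (∀ t → T t ≡ false) → count (λ t → P t ∧ T t) ≡ 0
count-∧-none P T T≡false = count-none (λ t → trans (cong (P t ∧_) (T≡false t)) (BoolP.∧-zeroʳ (P t)))

count-enumeration : ∀ {n ℓ} (C : Fin n → Bool) (e : Fin ℓ → Fin n) → Injective _≡_ _≡_ e →
  (∀ t → C (e t) ≡ true) → (∀ i → C i ≡ true → ∃ λ t → e t ≡ i) →
  ∀ p → count p ≡ count (λ i → not (C i) ∧ p i) ℕ.+ count (p ∘ e)
count-enumeration {ℓ = zero} C e inj onE onto p = trans (count-cong outside) (sym (ℕP.+-identityʳ _))
  where
  outside : ∀ i → p i ≡ not (C i) ∧ p i
  outside i with C i in Ci
  ... | true  with () ← proj₁ (onto i Ci)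
  ... | false = refl
count-enumeration {ℓ = suc ℓ} C e inj onE onto p = begin
  count p
    ≡⟨ count-enumeration C′ (e ∘ suc) (FinP.suc-injective ∘ inj) onE′ onto′ p ⟩
  count (λ i → not (C′ i) ∧ p i) ℕ.+ count (p ∘ e ∘ suc)              ≡⟨ cong (ℕ._+ count (p ∘ e ∘ suc)) remove-a ⟩
  𝟙 (p a) ℕ.+ count (λ i → not (C i) ∧ p i) ℕ.+ count (p ∘ e ∘ suc)  ≡⟨ shuffle (𝟙 (p a)) _ _ ⟩
  count (λ i → not (C i) ∧ p i) ℕ.+ count (p ∘ e)                     ∎
  where
  open ≡-Reasoning
  shuffle : ∀ x y z → x ℕ.+ y ℕ.+ z ≡ y ℕ.+ (x ℕ.+ z)
  shuffle = solve 3 (λ x y z → x :+ y :+ z := y :+ (x :+ z)) refl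
    where open ℕ-Solver
  a : Fin _
  a = e zero
  C′ : Fin _ → Bool
  C′ i = C i ∧ not (does (i ≟ a))
  C′-a : C′ a ≡ false
  C′-a rewrite dec-true (a ≟ a) refl = BoolP.∧-zeroʳ (C a)
  C′-off : ∀ {j} → j ≢ a → C′ j ≡ C j
  C′-off {j} j≢a rewrite dec-false (j ≟ a) j≢a = BoolP.∧-identityʳ (C j)
  onE′ : ∀ t → C′ (e (suc t)) ≡ true
  onE′ t = trans (C′-off (λ e≡a → FinP.0≢1+n (sym (inj e≡a)))) (onE (suc t))
  onto′ : ∀ i → C′ i ≡ true → ∃ λ t → e (suc t) ≡ i
  onto′ i C′i = from-onto (i ≟ a)
    where
    from-onto : Dec (i ≡ a) → ∃ λ t → e (suc t) ≡ i
    from-onto (yes refl) with () ← trans (sym C′-a) C′i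
    from-onto (no i≢a) with onto i (trans (sym (C′-off i≢a)) C′i)
    ... | zero  , a≡i  = ⊥-elim (i≢a (sym a≡i))
    ... | suc t , et≡i = t , et≡i
  h : Fin _ → ℕ
  h i = 𝟙 (not (C′ i) ∧ p i)
  erased : ∀ j → updateAt h a (λ _ → 0) j ≡ 𝟙 (not (C j) ∧ p j)
  erased j with j ≟ a
  ... | yes refl rewrite onE zero = VecFP.updateAt-updates j h
  ... | no  j≢a  = trans (VecFP.updateAt-minimal j a h j≢a) (cong (λ c → 𝟙 (not c ∧ p j)) (C′-off j≢a))
  remove-a : count (λ i → not (C′ i) ∧ p i) ≡ 𝟙 (p a) ℕ.+ count (λ i → not (C i) ∧ p i)
  remove-a = trans (sum-erase ℕP.+-0-commutativeMonoid h a)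
    (cong₂ ℕ._+_ (cong (λ c → 𝟙 (not c ∧ p a)) C′-a) (ℕΣ.sum-cong-≗ erased))

atLeast : ℚ → ℚ → Bool
atLeast θ x = does (θ ℚP.≤? x)

isPositive : ℚ → Bool
isPositive x = does (0ℚ ℚP.<? x)

superlevel : ∀ {N} → ℚ → (Fin N → ℚ) → ℕ
superlevel θ y = count (atLeast θ ∘ y)

superlevel₂ : ∀ {N} → ℚ → ℚ → (Fin N → ℚ) → (Fin N → ℚ) → ℕ
superlevel₂ θ η x y = count (λ k → atLeast θ (x k) ∧ atLeast η (y k))

NonNeg : ∀ {N} → (Fin N → ℚ) → Set
NonNeg z = ∀ k → 0ℚ ≤ z k

atLeast-cong : ∀ {θ x θ′ x′} → (θ ≤ x → θ′ ≤ x′) → (θ′ ≤ x′ → θ ≤ x) → atLeast θ x ≡ atLeast θ′ x′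
atLeast-cong {θ} {x} {θ′} {x′} to from with θ ℚP.≤? x
... | yes θ≤x = trans (dec-true (θ ℚP.≤? x) θ≤x) (sym (dec-true (θ′ ℚP.≤? x′) (to θ≤x)))
... | no  θ≰x = trans (dec-false (θ ℚP.≤? x) θ≰x) (sym (dec-false (θ′ ℚP.≤? x′) (θ≰x ∘ from)))

atLeast-0 : ∀ {θ} → 0ℚ < θ → atLeast θ 0ℚ ≡ false
atLeast-0 θ>0 = dec-false (_ ℚP.≤? 0ℚ) (<⇒≱ θ>0)

atLeast-true⁻¹ : ∀ {θ x} → atLeast θ x ≡ true → θ ≤ x
atLeast-true⁻¹ {θ} {x} eq with θ ℚP.≤? x
... | yes θ≤x = θ≤x
... | no  θ≰x with () ← trans (sym (dec-false (θ ℚP.≤? x) θ≰x)) eq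

atLeast-false⁻¹ : ∀ {θ x} → atLeast θ x ≡ false → x < θ
atLeast-false⁻¹ {θ} {x} eq with θ ℚP.≤? x
... | yes θ≤x with () ← trans (sym (dec-true (θ ℚP.≤? x) θ≤x)) eq
... | no  θ≰x = ℚP.≰⇒> θ≰x

atLeast-mono : ∀ {θ x y} → x ≤ y → atLeast θ x ≡ true → atLeast θ y ≡ true
atLeast-mono {θ} {x} {y} x≤y θ≤x = dec-true (θ ℚP.≤? y) (ℚP.≤-trans (atLeast-true⁻¹ {θ} θ≤x) x≤y)

peel : ℚ → ℚ → ℚ
peel m z = z - m * ℕ→ℚ (𝟙 (atLeast m z))

peel-decompose : ∀ m z → z ≡ m * ℕ→ℚ (𝟙 (atLeast m z)) + peel m z
peel-decompose m z = solve 2 (λ z i → z := i :+ (z :- i)) refl z (m * ℕ→ℚ (𝟙 (atLeast m z)))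
  where open ℚ-Solver

Σᶠ-peel : ∀ {N} m (z : Fin N → ℚ) → Σᶠ z ≡ m * ℕ→ℚ (superlevel m z) + Σᶠ (peel m ∘ z)
Σᶠ-peel m z = begin
  Σᶠ z                                                      ≡⟨ Σᶠ-cong (λ k → peel-decompose m (z k)) ⟩
  Σᶠ (λ k → m * 𝟙ℚ k + peel m (z k))                        ≡⟨ Σᶠ-distrib-+ (λ k → m * 𝟙ℚ k) (peel m ∘ z) ⟩
  Σᶠ (λ k → m * 𝟙ℚ k) + Σᶠ (peel m ∘ z)                     ≡⟨ cong (_+ Σᶠ (peel m ∘ z)) (Σᶠ-distribˡ-* m 𝟙ℚ) ⟩
  m * Σᶠ 𝟙ℚ + Σᶠ (peel m ∘ z)
    ≡⟨ cong (λ s → m * s + Σᶠ (peel m ∘ z)) (Σᶠ-𝟙 (atLeast m ∘ z)) ⟩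
  m * ℕ→ℚ (superlevel m z) + Σᶠ (peel m ∘ z)                ∎
  where
  open ≡-Reasoning
  𝟙ℚ : Fin _ → ℚ
  𝟙ℚ k = ℕ→ℚ (𝟙 (atLeast m (z k)))

-- Under the gap hypothesis z ≡ 0ℚ ⊎ m ≤ z, peeling m off z is z ↦ max (z - m) 0.
module _ {m : ℚ} (m>0 : 0ℚ < m) where

  peel-cases : ∀ {z} → z ≡ 0ℚ ⊎ m ≤ z → (z ≡ 0ℚ × peel m z ≡ 0ℚ) ⊎ (m ≤ z × peel m z ≡ z - m)
  peel-cases (inj₁ refl) = inj₁ (refl , trans (cong (λ b → 0ℚ - m * ℕ→ℚ (𝟙 b)) (atLeast-0 m>0))
    (solve 1 (λ m → con 0ℚ :- m :* con 0ℚ := con 0ℚ) refl m))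
    where open ℚ-Solver
  peel-cases {z} (inj₂ m≤z) = inj₂ (m≤z , trans (cong (λ b → z - m * ℕ→ℚ (𝟙 b)) (dec-true (m ℚP.≤? z) m≤z))
    (cong (λ s → z - s) (ℚP.*-identityʳ m)))

  peel-nonNeg : ∀ {z} → z ≡ 0ℚ ⊎ m ≤ z → 0ℚ ≤ peel m z
  peel-nonNeg gap = [ (λ (_ , peel≡0) → ℚP.≤-reflexive (sym peel≡0))
                    , (λ (m≤z , peel≡) → subst (0ℚ ≤_) (sym peel≡) (p≤q⇒0≤q-p m≤z)) ]′ (peel-cases gap)

  atLeast-peel : ∀ {z η} → z ≡ 0ℚ ⊎ m ≤ z → 0ℚ < η → atLeast η (peel m z) ≡ atLeast (η + m) z
  atLeast-peel {z} {η} gap η>0 = [ vanished , shifted ]′ (peel-cases gap)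
    where
    open ℚ-Solver
    vanished : z ≡ 0ℚ × peel m z ≡ 0ℚ → atLeast η (peel m z) ≡ atLeast (η + m) z
    vanished (refl , peel≡0) = trans (cong (atLeast η) peel≡0)
      (trans (atLeast-0 η>0) (sym (atLeast-0 (ℚP.<-trans η>0 (p<p+q m>0)))))
    shifted : m ≤ z × peel m z ≡ z - m → atLeast η (peel m z) ≡ atLeast (η + m) z
    shifted (_ , peel≡) = trans (cong (atLeast η) peel≡) (atLeast-cong
      (λ η≤z-m → subst (η + m ≤_) (solve 2 (λ z m → z :- m :+ m := z) refl z m) (ℚP.+-monoˡ-≤ m η≤z-m))
      (λ η+m≤z → subst (_≤ z - m) (solve 2 (λ η m → η :+ m :- m := η) refl η m) (ℚP.+-monoˡ-≤ (- m) η+m≤z)))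

  peel-support : ∀ {z} → z ≡ 0ℚ ⊎ m ≤ z → isPositive (peel m z) ≡ true → isPositive z ≡ true
  peel-support gap = [ (λ (_ , peel≡0) pos → contradiction (trans (sym (cong isPositive peel≡0)) pos) λ ())
                     , (λ (m≤z , _) _ → dec-true (0ℚ ℚP.<? _) (ℚP.<-≤-trans m>0 m≤z)) ]′ (peel-cases gap)

  peel-self : isPositive (peel m m) ≡ false
  peel-self = [ (λ (m≡0 , _) → ⊥-elim (ℚP.<-irrefl (sym m≡0) m>0))
              , (λ (_ , peel≡) → trans (cong isPositive (trans peel≡ (ℚP.+-inverseʳ m)))
                                       (dec-false (0ℚ ℚP.<? 0ℚ) (ℚP.<-irrefl refl))) ]′
              (peel-cases (inj₂ ℚP.≤-refl))

widen-gap : ∀ {m m′ z} → m ≤ m′ → z ≡ 0ℚ ⊎ m′ ≤ z → z ≡ 0ℚ ⊎ m ≤ z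
widen-gap m≤m′ = [ inj₁ , inj₂ ∘ ℚP.≤-trans m≤m′ ]′

minPositive : ∀ {N} (z : Fin N → ℚ) → NonNeg z →
  (∀ k → z k ≡ 0ℚ) ⊎ (∃ λ k → 0ℚ < z k × ∀ j → z j ≡ 0ℚ ⊎ z k ≤ z j)
minPositive {zero}  z z≥0 = inj₁ λ ()
minPositive {suc N} z z≥0 with minPositive (z ∘ suc) (z≥0 ∘ suc) | nonNeg-cases (z≥0 zero)
... | inj₁ tail≡0            | inj₁ z₀≡0 = inj₁ λ { zero → z₀≡0 ; (suc j) → tail≡0 j }
... | inj₁ tail≡0            | inj₂ z₀>0 = inj₂ (zero , z₀>0 , λ { zero → inj₂ ℚP.≤-refl ; (suc j) → inj₁ (tail≡0 j) })
... | inj₂ (k , zₖ>0 , least) | inj₁ z₀≡0 = inj₂ (suc k , zₖ>0 , λ { zero → inj₁ z₀≡0 ; (suc j) → least j })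
... | inj₂ (k , zₖ>0 , least) | inj₂ z₀>0 with ℚP.≤-total (z zero) (z (suc k))
...   | inj₁ z₀≤zₖ = inj₂ (zero , z₀>0 , λ { zero → inj₂ ℚP.≤-refl ; (suc j) → widen-gap z₀≤zₖ (least j) })
...   | inj₂ zₖ≤z₀ = inj₂ (suc k , zₖ>0 , λ { zero → inj₂ zₖ≤z₀ ; (suc j) → least j })

record LeastPositive {N} (z z′ : Fin N → ℚ) : Set where
  field
    m        : ℚ
    m>0      : 0ℚ < m
    gap      : ∀ k → z k ≡ 0ℚ ⊎ m ≤ z k
    gap′     : ∀ k → z′ k ≡ 0ℚ ⊎ m ≤ z′ k
    attained : (∃ λ k → z k ≡ m) ⊎ (∃ λ k → z′ k ≡ m)

leastPositive : ∀ {N} (z z′ : Fin N → ℚ) → NonNeg z → NonNeg z′ →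
  ((∀ k → z k ≡ 0ℚ) × (∀ k → z′ k ≡ 0ℚ)) ⊎ LeastPositive z z′
leastPositive z z′ z≥0 z′≥0 with minPositive z z≥0 | minPositive z′ z′≥0
... | inj₁ z≡0               | inj₁ z′≡0                = inj₁ (z≡0 , z′≡0)
... | inj₂ (k , zₖ>0 , least) | inj₁ z′≡0                =
  inj₂ (record { m = z k ; m>0 = zₖ>0 ; gap = least ; gap′ = inj₁ ∘ z′≡0 ; attained = inj₁ (k , refl) })
... | inj₁ z≡0               | inj₂ (k , z′ₖ>0 , least′) =
  inj₂ (record { m = z′ k ; m>0 = z′ₖ>0 ; gap = inj₁ ∘ z≡0 ; gap′ = least′ ; attained = inj₂ (k , refl) })
... | inj₂ (k , zₖ>0 , least) | inj₂ (k′ , z′ₖ′>0 , least′) with ℚP.≤-total (z k) (z′ k′)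
...   | inj₁ zₖ≤z′ₖ′ = inj₂ (record { m = z k ; m>0 = zₖ>0 ; gap = least
                                     ; gap′ = widen-gap zₖ≤z′ₖ′ ∘ least′ ; attained = inj₁ (k , refl) })
...   | inj₂ z′ₖ′≤zₖ = inj₂ (record { m = z′ k′ ; m>0 = z′ₖ′>0 ; gap = widen-gap z′ₖ′≤zₖ ∘ least
                                     ; gap′ = least′ ; attained = inj₂ (k′ , refl) })

positives : ∀ {N} → (Fin N → ℚ) → ℕ
positives z = count (isPositive ∘ z)

module _ {N} {z z′ : Fin N → ℚ} (L : LeastPositive z z′) where
  open LeastPositive L

  peel-positives-< : positives (peel m ∘ z) ℕ.+ positives (peel m ∘ z′) ℕ.< positives z ℕ.+ positives z′
  peel-positives-< = [ (λ (k , zₖ≡m) → ℕP.+-mono-<-≤ (drops gap k zₖ≡m) (shrinks gap′))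
                     , (λ (k , z′ₖ≡m) → ℕP.+-mono-≤-< (shrinks gap) (drops gap′ k z′ₖ≡m)) ]′ attained
    where
    shrinks : ∀ {y} → (∀ k → y k ≡ 0ℚ ⊎ m ≤ y k) → positives (peel m ∘ y) ℕ.≤ positives y
    shrinks gapy = count-mono (λ j → peel-support m>0 (gapy j))
    drops : ∀ {y} → (∀ k → y k ≡ 0ℚ ⊎ m ≤ y k) → ∀ k → y k ≡ m → positives (peel m ∘ y) ℕ.< positives y
    drops {y} gapy k yₖ≡m = count-mono-< (λ j → peel-support m>0 (gapy j)) k
      (trans (cong (isPositive ∘ peel m) yₖ≡m) (peel-self m>0))
      (trans (cong isPositive yₖ≡m) (dec-true (0ℚ ℚP.<? m) m>0))

-- By induction on the number of positive entries, which peeling the least positive value decreases.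
peel-induction : ∀ {N} (P : (Fin N → ℚ) → (Fin N → ℚ) → Set) →
  (∀ {z z′} → (∀ k → z k ≡ 0ℚ) → (∀ k → z′ k ≡ 0ℚ) → P z z′) →
  (∀ {z z′} (L : LeastPositive z z′) → P (peel (LeastPositive.m L) ∘ z) (peel (LeastPositive.m L) ∘ z′) → P z z′) →
  ∀ {z z′} → NonNeg z → NonNeg z′ → P z z′
peel-induction P base step {z} {z′} z≥0 z′≥0 = go _ z z′ z≥0 z′≥0 ℕP.≤-refl
  where
  go : ∀ fuel z z′ → NonNeg z → NonNeg z′ → positives z ℕ.+ positives z′ ℕ.≤ fuel → P z z′
  peel-step : ∀ fuel {z z′} → positives z ℕ.+ positives z′ ℕ.≤ fuel → LeastPositive z z′ → P z z′
  go fuel z z′ z≥0 z′≥0 bound =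
    [ (λ (z≡0 , z′≡0) → base z≡0 z′≡0) , peel-step fuel bound ]′ (leastPositive z z′ z≥0 z′≥0)
  peel-step zero       bound L = ⊥-elim (ℕP.n≮0 (ℕP.<-≤-trans (peel-positives-< L) bound))
  peel-step (suc fuel) bound L = step L (go fuel _ _ (peel-nonNeg m>0 ∘ gap) (peel-nonNeg m>0 ∘ gap′)
    (ℕP.≤-pred (ℕP.<-≤-trans (peel-positives-< L) bound)))
    where open LeastPositive L

Σᶠ-≤-bySuperlevels : ∀ {N} {y y′ : Fin N → ℚ} → NonNeg y → NonNeg y′ →
  (∀ η → 0ℚ < η → superlevel η y′ ℕ.≤ superlevel η y) → Σᶠ y′ ≤ Σᶠ y
Σᶠ-≤-bySuperlevels = peel-induction P base step
  where
  P : (Fin _ → ℚ) → (Fin _ → ℚ) → Set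
  P y y′ = (∀ η → 0ℚ < η → superlevel η y′ ℕ.≤ superlevel η y) → Σᶠ y′ ≤ Σᶠ y
  base : ∀ {y y′} → (∀ k → y k ≡ 0ℚ) → (∀ k → y′ k ≡ 0ℚ) → P y y′
  base y≡0 y′≡0 _ = ℚP.≤-reflexive (trans (Σᶠ-zero y′≡0) (sym (Σᶠ-zero y≡0)))
  step : ∀ {y y′} (L : LeastPositive y y′) → P (peel (LeastPositive.m L) ∘ y) (peel (LeastPositive.m L) ∘ y′) → P y y′
  step {y} {y′} L ih levels = subst₂ _≤_ (sym (Σᶠ-peel m y′)) (sym (Σᶠ-peel m y))
    (ℚP.+-mono-≤ (*-monoˡ-≤-0≤ (ℚP.<⇒≤ m>0) (ℕ→ℚ-mono-≤ (levels m m>0))) (ih peeled-levels))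
    where
    open LeastPositive L
    peeled-levels : ∀ η → 0ℚ < η → superlevel η (peel m ∘ y′) ℕ.≤ superlevel η (peel m ∘ y)
    peeled-levels η η>0 = subst₂ ℕ._≤_
      (count-cong (λ k → sym (atLeast-peel m>0 (gap′ k) η>0))) (count-cong (λ k → sym (atLeast-peel m>0 (gap k) η>0)))
      (levels (η + m) (ℚP.<-trans η>0 (p<p+q m>0)))

mask : Bool → ℚ → ℚ
mask b w = ℕ→ℚ (𝟙 b) * w

mask-nonNeg : ∀ b {w} → 0ℚ ≤ w → 0ℚ ≤ mask b w
mask-nonNeg b w≥0 = *-nonNeg (ℕ→ℚ-nonNeg (𝟙 b)) w≥0

atLeast-mask : ∀ b {η w} → 0ℚ < η → atLeast η (mask b w) ≡ b ∧ atLeast η w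
atLeast-mask true  {η} {w} η>0 = cong (atLeast η) (ℚP.*-identityˡ w)
atLeast-mask false {η} {w} η>0 = trans (cong (atLeast η) (ℚP.*-zeroˡ w)) (atLeast-0 η>0)

Σᶠ-peel-* : ∀ {N} m (x y : Fin N → ℚ) →
  Σᶠ (λ k → x k * y k) ≡ m * Σᶠ (λ k → mask (atLeast m (x k)) (y k)) + Σᶠ (λ k → peel m (x k) * y k)
Σᶠ-peel-* m x y = begin
  Σᶠ (λ k → x k * y k)                                    ≡⟨ Σᶠ-cong split ⟩
  Σᶠ (λ k → m * masked k + peeled k)                      ≡⟨ Σᶠ-distrib-+ (λ k → m * masked k) peeled ⟩
  Σᶠ (λ k → m * masked k) + Σᶠ peeled                     ≡⟨ cong (_+ Σᶠ peeled) (Σᶠ-distribˡ-* m masked) ⟩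
  m * Σᶠ masked + Σᶠ peeled                               ∎
  where
  open ≡-Reasoning
  masked peeled : Fin _ → ℚ
  masked k = mask (atLeast m (x k)) (y k)
  peeled k = peel m (x k) * y k
  split : ∀ k → x k * y k ≡ m * masked k + peeled k
  split k = trans (cong (_* y k) (peel-decompose m (x k)))
    (solve 4 (λ m i p y → (m :* i :+ p) :* y := m :* (i :* y) :+ p :* y)
      refl m (ℕ→ℚ (𝟙 (atLeast m (x k)))) (peel m (x k)) (y k))
    where open ℚ-Solver

Σᶠ-*-≤-bySuperlevels : ∀ {N} {x y x′ y′ : Fin N → ℚ} → NonNeg x → NonNeg y → NonNeg x′ → NonNeg y′ →
  (∀ θ η → 0ℚ < θ → 0ℚ < η → superlevel₂ θ η x′ y′ ℕ.≤ superlevel₂ θ η x y) →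
  Σᶠ (λ k → x′ k * y′ k) ≤ Σᶠ (λ k → x k * y k)
Σᶠ-*-≤-bySuperlevels x≥0 y≥0 x′≥0 y′≥0 levels = peel-induction P base step x≥0 x′≥0 y≥0 y′≥0 levels
  where
  P : (Fin _ → ℚ) → (Fin _ → ℚ) → Set
  P x x′ = ∀ {y y′} → NonNeg y → NonNeg y′ →
    (∀ θ η → 0ℚ < θ → 0ℚ < η → superlevel₂ θ η x′ y′ ℕ.≤ superlevel₂ θ η x y) →
    Σᶠ (λ k → x′ k * y′ k) ≤ Σᶠ (λ k → x k * y k)
  base : ∀ {x x′} → (∀ k → x k ≡ 0ℚ) → (∀ k → x′ k ≡ 0ℚ) → P x x′
  base {x} {x′} x≡0 x′≡0 {y} {y′} _ _ _ = ℚP.≤-reflexive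
    (trans (Σᶠ-zero (λ k → trans (cong (_* y′ k) (x′≡0 k)) (ℚP.*-zeroˡ (y′ k))))
      (sym (Σᶠ-zero (λ k → trans (cong (_* y k) (x≡0 k)) (ℚP.*-zeroˡ (y k))))))
  step : ∀ {x x′} (L : LeastPositive x x′) → P (peel (LeastPositive.m L) ∘ x) (peel (LeastPositive.m L) ∘ x′) → P x x′
  step {x} {x′} L ih {y} {y′} y≥0 y′≥0 levels = subst₂ _≤_ (sym (Σᶠ-peel-* m x′ y′)) (sym (Σᶠ-peel-* m x y))
    (ℚP.+-mono-≤ (*-monoˡ-≤-0≤ (ℚP.<⇒≤ m>0) masked) (ih y≥0 y′≥0 peeled-levels))
    where
    open LeastPositive L
    masked-level : ∀ (x y : Fin _ → ℚ) η → 0ℚ < η →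
      superlevel η (λ k → mask (atLeast m (x k)) (y k)) ≡ superlevel₂ m η x y
    masked-level x y η η>0 = count-cong (λ k → atLeast-mask (atLeast m (x k)) η>0)
    masked : Σᶠ (λ k → mask (atLeast m (x′ k)) (y′ k)) ≤ Σᶠ (λ k → mask (atLeast m (x k)) (y k))
    masked = Σᶠ-≤-bySuperlevels
      (λ k → mask-nonNeg (atLeast m (x k)) (y≥0 k)) (λ k → mask-nonNeg (atLeast m (x′ k)) (y′≥0 k))
      (λ η η>0 → subst₂ ℕ._≤_ (sym (masked-level x′ y′ η η>0)) (sym (masked-level x y η η>0)) (levels m η m>0 η>0))
    peeled-level : ∀ (x y : Fin _ → ℚ) → (∀ k → x k ≡ 0ℚ ⊎ m ≤ x k) → ∀ θ η → 0ℚ < θ →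
      superlevel₂ θ η (peel m ∘ x) y ≡ superlevel₂ (θ + m) η x y
    peeled-level x y gapx θ η θ>0 = count-cong (λ k → cong (_∧ atLeast η (y k)) (atLeast-peel m>0 (gapx k) θ>0))
    peeled-levels : ∀ θ η → 0ℚ < θ → 0ℚ < η → superlevel₂ θ η (peel m ∘ x′) y′ ℕ.≤ superlevel₂ θ η (peel m ∘ x) y
    peeled-levels θ η θ>0 η>0 =
      subst₂ ℕ._≤_ (sym (peeled-level x′ y′ gap′ θ η θ>0)) (sym (peeled-level x y gap θ η θ>0))
      (levels (θ + m) η (ℚP.<-trans θ>0 (p<p+q m>0)) η>0)

++-nonNeg : ∀ {m n} {x : Fin m → ℚ} {x′ : Fin n → ℚ} → NonNeg x → NonNeg x′ → NonNeg (x ++ x′)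
++-nonNeg {m} {x = x} {x′} x≥0 x′≥0 k = [,]-nonNeg (Fin.splitAt m k)
  where
  [,]-nonNeg : ∀ s → 0ℚ ≤ [ x , x′ ]′ s
  [,]-nonNeg (inj₁ i) = x≥0 i
  [,]-nonNeg (inj₂ j) = x′≥0 j

Σᶠ-++-* : ∀ {m n} (x y : Fin m → ℚ) (x′ y′ : Fin n → ℚ) →
  Σᶠ (λ k → (x ++ x′) k * (y ++ y′) k) ≡ Σᶠ (λ i → x i * y i) + Σᶠ (λ j → x′ j * y′ j)
Σᶠ-++-* {m} x y x′ y′ = trans (Σᶠ-↑ {m} (λ k → (x ++ x′) k * (y ++ y′) k)) (cong₂ _+_
  (Σᶠ-cong (λ i → cong₂ _*_ (VecFP.lookup-++ˡ x x′ i) (VecFP.lookup-++ˡ y y′ i)))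
  (Σᶠ-cong (λ j → cong₂ _*_ (VecFP.lookup-++ʳ x x′ j) (VecFP.lookup-++ʳ y y′ j))))

superlevel₂-++ : ∀ {m n} θ η (x y : Fin m → ℚ) (x′ y′ : Fin n → ℚ) →
  superlevel₂ θ η (x ++ x′) (y ++ y′) ≡ superlevel₂ θ η x y ℕ.+ superlevel₂ θ η x′ y′
superlevel₂-++ {m} θ η x y x′ y′ = trans (sum-↑ ℕP.+-0-commutativeMonoid {m} _) (cong₂ ℕ._+_
  (count-cong (λ i → cong₂ (λ u v → atLeast θ u ∧ atLeast η v) (VecFP.lookup-++ˡ x x′ i) (VecFP.lookup-++ˡ y y′ i)))
  (count-cong (λ j → cong₂ (λ u v → atLeast θ u ∧ atLeast η v) (VecFP.lookup-++ʳ x x′ j) (VecFP.lookup-++ʳ y y′ j))))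

Balanced : ℕ → ℕ → Set
Balanced a b = a ℕ.≤ suc b × b ℕ.≤ suc a

Balanced-sym : ∀ {a b} → Balanced a b → Balanced b a
Balanced-sym (a≤1+b , b≤1+a) = b≤1+a , a≤1+b

Balanced-+ˡ : ∀ k {a b} → Balanced a b → Balanced (k ℕ.+ a) (k ℕ.+ b)
Balanced-+ˡ k (a≤1+b , b≤1+a) =
  ℕP.≤-trans (ℕP.+-monoʳ-≤ k a≤1+b) (ℕP.≤-reflexive (ℕP.+-suc k _)) ,
  ℕP.≤-trans (ℕP.+-monoʳ-≤ k b≤1+a) (ℕP.≤-reflexive (ℕP.+-suc k _))

Balanced-complement : ∀ {a b p q} → a ℕ.+ p ≡ b ℕ.+ q → Balanced a b → Balanced p q
Balanced-complement a+p≡b+q (a≤1+b , b≤1+a) = shift a+p≡b+q b≤1+a , shift (sym a+p≡b+q) a≤1+b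
  where
  open ℕP.≤-Reasoning
  shift : ∀ {a b p q} → a ℕ.+ p ≡ b ℕ.+ q → b ℕ.≤ suc a → p ℕ.≤ suc q
  shift {a} {b} {p} {q} a+p≡b+q b≤1+a = ℕP.+-cancelˡ-≤ a p (suc q) (begin
    a ℕ.+ p     ≡⟨ a+p≡b+q ⟩
    b ℕ.+ q     ≤⟨ ℕP.+-monoˡ-≤ q b≤1+a ⟩
    suc a ℕ.+ q ≡⟨ sym (ℕP.+-suc a q) ⟩
    a ℕ.+ suc q ∎)

∸-vanish-≤ : ∀ {a b K c} → a ℕ.≤ K → b ℕ.≤ K → (a ℕ.∸ K) ℕ.+ (b ℕ.∸ K) ℕ.≤ c
∸-vanish-≤ a≤K b≤K rewrite ℕP.m≤n⇒m∸n≡0 a≤K | ℕP.m≤n⇒m∸n≡0 b≤K = z≤n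

-- The convexity of a ↦ a ∸ K: among pairs with a given sum, balanced ones minimise (a ∸ K) + (b ∸ K).
∸-balanced-≤ : ∀ {a b a′ b′} K → a ℕ.+ b ≡ a′ ℕ.+ b′ → Balanced a′ b′ →
  (a′ ℕ.∸ K) ℕ.+ (b′ ℕ.∸ K) ℕ.≤ (a ℕ.∸ K) ℕ.+ (b ℕ.∸ K)
∸-balanced-≤ {a} {b} {a′} {b′} K sum≡ (a′≤1+b′ , b′≤1+a′) with K ℕ.≤? a′ | K ℕ.≤? b′
... | yes K≤a′ | yes K≤b′ = ℕP.+-cancelʳ-≤ (K ℕ.+ K) _ _ (begin
  (a′ ℕ.∸ K) ℕ.+ (b′ ℕ.∸ K) ℕ.+ (K ℕ.+ K) ≡⟨ shuffle (a′ ℕ.∸ K) (b′ ℕ.∸ K) K ⟩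
  (a′ ℕ.∸ K ℕ.+ K) ℕ.+ (b′ ℕ.∸ K ℕ.+ K)   ≡⟨ cong₂ ℕ._+_ (ℕP.m∸n+n≡m K≤a′) (ℕP.m∸n+n≡m K≤b′) ⟩
  a′ ℕ.+ b′                               ≡⟨ sym sum≡ ⟩
  a ℕ.+ b                                 ≤⟨ ℕP.+-mono-≤ (≤∸+ a) (≤∸+ b) ⟩
  (a ℕ.∸ K ℕ.+ K) ℕ.+ (b ℕ.∸ K ℕ.+ K)     ≡⟨ sym (shuffle (a ℕ.∸ K) (b ℕ.∸ K) K) ⟩
  (a ℕ.∸ K) ℕ.+ (b ℕ.∸ K) ℕ.+ (K ℕ.+ K)   ∎)
  where
  open ℕP.≤-Reasoning
  shuffle : ∀ x y k → x ℕ.+ y ℕ.+ (k ℕ.+ k) ≡ (x ℕ.+ k) ℕ.+ (y ℕ.+ k)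
  shuffle = solve 3 (λ x y k → x :+ y :+ (k :+ k) := (x :+ k) :+ (y :+ k)) refl
    where open ℕ-Solver
  ≤∸+ : ∀ x → x ℕ.≤ x ℕ.∸ K ℕ.+ K
  ≤∸+ x = subst (x ℕ.≤_) (ℕP.+-comm K (x ℕ.∸ K)) (ℕP.m≤n+m∸n x K)
... | no K≰a′ | _        = ∸-vanish-≤ (ℕP.<⇒≤ (ℕP.≰⇒> K≰a′)) (ℕP.≤-trans b′≤1+a′ (ℕP.≰⇒> K≰a′))
... | yes _   | no K≰b′  = ∸-vanish-≤ (ℕP.≤-trans a′≤1+b′ (ℕP.≰⇒> K≰b′)) (ℕP.<⇒≤ (ℕP.≰⇒> K≰b′))

isEven isOdd : ℕ → Bool
isEven zero    = true
isEven (suc m) = isOdd m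
isOdd zero    = false
isOdd (suc m) = isEven m

parity : ∀ m → (m % 2 ≡ 0 × isEven m ≡ true × isOdd m ≡ false) ⊎ (m % 2 ≡ 1 × isEven m ≡ false × isOdd m ≡ true)
parity zero          = inj₁ (refl , refl , refl)
parity (suc zero)    = inj₂ (refl , refl , refl)
parity (suc (suc m)) = parity m

evens odds : ∀ {ℓ} → (Fin ℓ → Bool) → ℕ
evens T = count (λ t → isEven (toℕ t) ∧ T t)
odds  T = count (λ t → isOdd (toℕ t) ∧ T t)

DownClosed Convex : ∀ {ℓ} → (Fin ℓ → Bool) → Set
DownClosed T = ∀ {s t} → s ≤ᶠ t → T t ≡ true → T s ≡ true
Convex T = ∀ {r s t} → r ≤ᶠ s → s ≤ᶠ t → T r ≡ true → T t ≡ true → T s ≡ true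

all-false : ∀ {ℓ} (T : Fin (suc ℓ) → Bool) → DownClosed T → T zero ≡ false → ∀ t → T t ≡ false
all-false T closed T₀≡false t =
  BoolP.¬-not (λ Tₜ≡true → contradiction (trans (sym (closed z≤n Tₜ≡true)) T₀≡false) λ ())

prefix-parity : ∀ {ℓ} (T : Fin ℓ → Bool) → DownClosed T → odds T ℕ.≤ evens T × evens T ℕ.≤ suc (odds T)
prefix-parity {zero}  T closed = z≤n , z≤n
prefix-parity {suc ℓ} T closed with T zero in T₀
... | true  = let (o≤e , e≤1+o) = prefix-parity (T ∘ suc) (closed ∘ s≤s) in e≤1+o , s≤s o≤e
... | false = subst₂ (λ e o → e ℕ.≤ o × o ℕ.≤ suc e)
  (sym (count-∧-none (isEven ∘ toℕ) (T ∘ suc) empty))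
  (sym (count-∧-none (isOdd ∘ toℕ) (T ∘ suc) empty))
  (z≤n , z≤n)
  where
  empty : ∀ t → T (suc t) ≡ false
  empty t = all-false T closed T₀ (suc t)

convex-parity : ∀ {ℓ} (T : Fin ℓ → Bool) → Convex T → Balanced (evens T) (odds T)
convex-parity {zero}  T convex = z≤n , z≤n
convex-parity {suc ℓ} T convex with T zero in T₀
... | true  = let (o≤e , e≤1+o) = prefix-parity (T ∘ suc) (λ s≤t → convex z≤n (s≤s s≤t) T₀)
              in s≤s o≤e , ℕP.≤-trans e≤1+o (ℕP.n≤1+n _)
... | false = Balanced-sym (convex-parity (T ∘ suc) (λ r≤s s≤t → convex (s≤s r≤s) (s≤s s≤t)))

⌊⌋-yes : ∀ {n} {a j : Fin n} → a ≡ j → ⌊ a ≟ j ⌋ ≡ true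
⌊⌋-yes {a = a} {j} a≡j with a ≟ j
... | yes _   = refl
... | no  a≢j = contradiction a≡j a≢j

⌊⌋-no : ∀ {n} {a j : Fin n} → a ≢ j → ⌊ a ≟ j ⌋ ≡ false
⌊⌋-no {a = a} {j} a≢j with a ≟ j
... | yes a≡j = contradiction a≡j a≢j
... | no  _   = refl

Σᶠ-δ : ∀ {n} (a : Fin n) (f : Fin n → ℚ) → Σᶠ (λ j → if ⌊ a ≟ j ⌋ then f j else 0ℚ) ≡ f a
Σᶠ-δ a f = trans (Σᶠ-single _ a (λ j j≢a → cong (λ e → if e then f j else 0ℚ) (⌊⌋-no (j≢a ∘ sym))))
  (cong (λ e → if e then f a else 0ℚ) (⌊⌋-yes refl))

Σᶠ-δ′ : ∀ {n} (j : Fin n) → Σᶠ (λ a → if ⌊ a ≟ j ⌋ then 1ℚ else 0ℚ) ≡ 1ℚ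
Σᶠ-δ′ j = trans (Σᶠ-single _ j (λ a a≢j → cong (λ e → if e then 1ℚ else 0ℚ) (⌊⌋-no a≢j)))
  (cong (λ e → if e then 1ℚ else 0ℚ) (⌊⌋-yes refl))

combination-zero : ∀ {t q r} → 0ℚ < t → t < 1ℚ → 0ℚ ≤ q → 0ℚ ≤ r →
  t * q + (1ℚ - t) * r ≡ 0ℚ → q ≡ 0ℚ × r ≡ 0ℚ
combination-zero {t} {q} {r} t>0 t<1 q≥0 r≥0 sum≡0 =
  factor-zero t>0 q≥0 (summand-zero tq≥0 sr≥0 sum≡0) ,
  factor-zero (p<q⇒0<q-p t<1) r≥0 (summand-zero sr≥0 tq≥0 (trans (ℚP.+-comm ((1ℚ - t) * r) (t * q)) sum≡0))
  where
  tq≥0 : 0ℚ ≤ t * q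
  tq≥0 = *-nonNeg (ℚP.<⇒≤ t>0) q≥0
  sr≥0 : 0ℚ ≤ (1ℚ - t) * r
  sr≥0 = *-nonNeg (p≤q⇒0≤q-p (ℚP.<⇒≤ t<1)) r≥0
  summand-zero : ∀ {a b} → 0ℚ ≤ a → 0ℚ ≤ b → a + b ≡ 0ℚ → a ≡ 0ℚ
  summand-zero {a} a≥0 b≥0 a+b≡0 = ℚP.≤-antisym (subst (a ≤_) a+b≡0 (p≤p+q b≥0)) a≥0
  factor-zero : ∀ {s u} → 0ℚ < s → 0ℚ ≤ u → s * u ≡ 0ℚ → u ≡ 0ℚ
  factor-zero s>0 u≥0 su≡0 = [ id , (λ u>0 → ⊥-elim (ℚP.<-irrefl (sym su≡0) (*-pos s>0 u>0))) ]′ (nonNeg-cases u≥0)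

convex-01 : ∀ {t q r e} → 0ℚ < t → t < 1ℚ → 0ℚ ≤ q → q ≤ 1ℚ → 0ℚ ≤ r → r ≤ 1ℚ →
  e ≡ 0ℚ ⊎ e ≡ 1ℚ → e ≡ t * q + (1ℚ - t) * r → q ≡ r
convex-01 t>0 t<1 q≥0 _ r≥0 _ (inj₁ refl) 0≡comb =
  let (q≡0 , r≡0) = combination-zero t>0 t<1 q≥0 r≥0 (sym 0≡comb) in trans q≡0 (sym r≡0)
convex-01 {t} {q} {r} t>0 t<1 _ q≤1 _ r≤1 (inj₂ refl) 1≡comb =
  let (1-q≡0 , 1-r≡0) = combination-zero t>0 t<1 (p≤q⇒0≤q-p q≤1) (p≤q⇒0≤q-p r≤1) complement
  in trans (flip q) (trans (cong (λ p → 1ℚ - p) (trans 1-q≡0 (sym 1-r≡0))) (sym (flip r)))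
  where
  open ℚ-Solver
  flip : ∀ p → p ≡ 1ℚ - (1ℚ - p)
  flip p = solve 1 (λ p → p := con 1ℚ :- (con 1ℚ :- p)) refl p
  complement : t * (1ℚ - q) + (1ℚ - t) * (1ℚ - r) ≡ 0ℚ
  complement = trans (solve 3 (λ t q r → t :* (con 1ℚ :- q) :+ (con 1ℚ :- t) :* (con 1ℚ :- r)
                                          := con 1ℚ :- (t :* q :+ (con 1ℚ :- t) :* r)) refl t q r)
    (trans (cong (λ p → 1ℚ - p) (sym 1≡comb)) (ℚP.+-inverseʳ 1ℚ))

-- (z , w) lies below the line through (α , cA) and (β , cB), whose value at K is
-- ((β - K) cA + (K - α) cB) / (β - α).
record Below (α β cA cB z w : ℚ) : Set where
  constructor below
  field
    below≤ : (β - α) * w ≤ (β - z) * cA + (z - α) * cB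

below-endpointˡ : ∀ α β cA cB → Below α β cA cB α cA
below-endpointˡ α β cA cB = below (ℚP.≤-reflexive
  (solve 4 (λ α β cA cB → (β :- α) :* cA := (β :- α) :* cA :+ (α :- α) :* cB) refl α β cA cB))
  where open ℚ-Solver

below-endpointʳ : ∀ α β cA cB → Below α β cA cB β cB
below-endpointʳ α β cA cB = below (ℚP.≤-reflexive
  (solve 4 (λ α β cA cB → (β :- α) :* cB := (β :- β) :* cA :+ (β :- α) :* cB) refl α β cA cB))
  where open ℚ-Solver

below-split : ∀ {α β cA cB z z′ w w′} → z + z′ ≡ α + β → α ≤ β → w + w′ ≤ cA + cB →
  Below α β cA cB z w ⊎ Below α β cA cB z′ w′
below-split {α} {β} {cA} {cB} {z} {z′} {w} {w′} z+z′≡α+β α≤β w+w′≤ = ⊎-map below below (+-split-≤ (begin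
  (β - α) * w + (β - α) * w′                                     ≡⟨ sym (ℚP.*-distribˡ-+ (β - α) w w′) ⟩
  (β - α) * (w + w′)                                             ≤⟨ *-monoˡ-≤-0≤ (p≤q⇒0≤q-p α≤β) w+w′≤ ⟩
  (β - α) * (cA + cB)                                            ≡⟨ regroup ⟩
  (β - z) * cA + (z - α) * cB + ((β - z′) * cA + (z′ - α) * cB)  ∎))
  where
  open ℚP.≤-Reasoning
  open ℚ-Solver
  z′≡ : z′ ≡ α + β - z
  z′≡ = trans (solve 2 (λ z z′ → z′ := z :+ z′ :- z) refl z z′) (cong (_- z) z+z′≡α+β)
  regroup : (β - α) * (cA + cB) ≡ (β - z) * cA + (z - α) * cB + ((β - z′) * cA + (z′ - α) * cB)
  regroup = trans (solve 5 (λ α β z cA cB → (β :- α) :* (cA :+ cB)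
      := (β :- z) :* cA :+ (z :- α) :* cB :+ ((β :- (α :+ β :- z)) :* cA :+ ((α :+ β :- z) :- α) :* cB))
      refl α β z cA cB)
    (cong (λ u → (β - z) * cA + (z - α) * cB + ((β - u) * cA + (u - α) * cB)) (sym z′≡))

below-value : ∀ {α β cA cB K w} ι → ι * (β - α) ≡ 1ℚ → 0ℚ ≤ ι → Below α β cA cB K w →
  w ≤ ((β - K) * cA + (K - α) * cB) * ι
below-value {α} {β} {cA} {cB} {K} {w} ι ι-inv ι≥0 (below w-below) = begin
  w                    ≡⟨ trans (sym (ℚP.*-identityʳ w)) (cong (w *_) (sym ι-inv)) ⟩
  w * (ι * (β - α))    ≡⟨ solve 4 (λ w ι β α → w :* (ι :* (β :- α)) := (β :- α) :* w :* ι) refl w ι β α ⟩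
  (β - α) * w * ι      ≤⟨ *-monoʳ-≤-0≤ ι≥0 w-below ⟩
  ((β - K) * cA + (K - α) * cB) * ι ∎
  where
  open ℚP.≤-Reasoning
  open ℚ-Solver

below-interpolate : ∀ {α β cA cB x y cX cY K} ι κ →
  ι * (β - α) ≡ 1ℚ → 0ℚ ≤ ι → κ * (y - x) ≡ 1ℚ → 0ℚ ≤ κ →
  x ≤ K → K ≤ y → Below α β cA cB x cX → Below α β cA cB y cY →
  ((y - K) * cX + (K - x) * cY) * κ ≤ ((β - K) * cA + (K - α) * cB) * ι
below-interpolate {α} {β} {cA} {cB} {x} {y} {cX} {cY} {K} ι κ ι-inv ι≥0 κ-inv κ≥0 x≤K K≤y (below X≤) (below Y≤) = begin
  S * κ                    ≡⟨ trans (sym (ℚP.*-identityʳ (S * κ))) (cong (S * κ *_) (sym ι-inv)) ⟩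
  S * κ * (ι * (β - α))
    ≡⟨ solve 5 (λ S κ ι β α → S :* κ :* (ι :* (β :- α)) := (β :- α) :* S :* (κ :* ι)) refl S κ ι β α ⟩
  (β - α) * S * (κ * ι)    ≤⟨ *-monoʳ-≤-0≤ (*-nonNeg κ≥0 ι≥0) scaled ⟩
  (y - x) * T * (κ * ι)
    ≡⟨ solve 5 (λ T κ ι y x → (y :- x) :* T :* (κ :* ι) := T :* ι :* (κ :* (y :- x))) refl T κ ι y x ⟩
  T * ι * (κ * (y - x))    ≡⟨ trans (cong (T * ι *_) κ-inv) (ℚP.*-identityʳ (T * ι)) ⟩
  T * ι                    ∎
  where
  open ℚP.≤-Reasoning
  open ℚ-Solver
  S = (y - K) * cX + (K - x) * cY
  T = (β - K) * cA + (K - α) * cB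
  scaled : (β - α) * S ≤ (y - x) * T
  scaled = begin
    (β - α) * S
      ≡⟨ solve 7 (λ β α y K x cX cY → (β :- α) :* ((y :- K) :* cX :+ (K :- x) :* cY)
                                      := (y :- K) :* ((β :- α) :* cX) :+ (K :- x) :* ((β :- α) :* cY))
               refl β α y K x cX cY ⟩
    (y - K) * ((β - α) * cX) + (K - x) * ((β - α) * cY)
      ≤⟨ ℚP.+-mono-≤ (*-monoˡ-≤-0≤ (p≤q⇒0≤q-p K≤y) X≤) (*-monoˡ-≤-0≤ (p≤q⇒0≤q-p x≤K) Y≤) ⟩
    (y - K) * ((β - x) * cA + (x - α) * cB) + (K - x) * ((β - y) * cA + (y - α) * cB)
      ≡⟨ solve 7 (λ y K x β α cA cB → (y :- K) :* ((β :- x) :* cA :+ (x :- α) :* cB)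
                                      :+ (K :- x) :* ((β :- y) :* cA :+ (y :- α) :* cB)
                                      := (y :- x) :* ((β :- K) :* cA :+ (K :- α) :* cB)) refl y K x β α cA cB ⟩
    (y - x) * T ∎

-- With ι = 1 / (y - x), the weights (y - K) ι and (K - x) ι on x and y average to K.
module Weights (x y K ι : ℚ) (ι-inv : ι * (y - x) ≡ 1ℚ) where
  open ℚ-Solver

  weight-complement : 1ℚ - (y - K) * ι ≡ (K - x) * ι
  weight-complement = trans (cong (_- (y - K) * ι) (sym ι-inv))
    (solve 4 (λ ι x y K → ι :* (y :- x) :- (y :- K) :* ι := (K :- x) :* ι) refl ι x y K)

  weighted-mean : (y - K) * ι * x + (1ℚ - (y - K) * ι) * y ≡ K
  weighted-mean = begin
    (y - K) * ι * x + (1ℚ - (y - K) * ι) * y ≡⟨ cong (λ s → (y - K) * ι * x + s * y) weight-complement ⟩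
    (y - K) * ι * x + (K - x) * ι * y
      ≡⟨ solve 4 (λ ι x y K → (y :- K) :* ι :* x :+ (K :- x) :* ι :* y := K :* (ι :* (y :- x))) refl ι x y K ⟩
    K * (ι * (y - x))                        ≡⟨ trans (cong (K *_) ι-inv) (ℚP.*-identityʳ K) ⟩
    K                                        ∎
    where open ≡-Reasoning

  weighted-value : ∀ cX cY → (y - K) * ι * cX + (1ℚ - (y - K) * ι) * cY ≡ ((y - K) * cX + (K - x) * cY) * ι
  weighted-value cX cY = trans (cong (λ s → (y - K) * ι * cX + s * cY) weight-complement)
    (solve 6 (λ ι x y K cX cY → (y :- K) :* ι :* cX :+ (K :- x) :* ι :* cY := ((y :- K) :* cX :+ (K :- x) :* cY) :* ι)
      refl ι x y K cX cY)

∈⇒lookup : ∀ {n} {i : Fin n} {X : Subset n} → i ∈ X → lookup X i ≡ true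
∈⇒lookup = VecP.[]=⇒lookup

lookup⇒∈ : ∀ {n} {i : Fin n} {X : Subset n} → lookup X i ≡ true → i ∈ X
lookup⇒∈ {i = i} {X} = VecP.lookup⇒[]= i X

∉⇒lookup : ∀ {n} {i : Fin n} {X : Subset n} → i ∉ X → lookup X i ≡ false
∉⇒lookup i∉X = BoolP.¬-not (i∉X ∘ lookup⇒∈)

lookup⇒∉ : ∀ {n} {i : Fin n} {X : Subset n} → lookup X i ≡ false → i ∉ X
lookup⇒∉ Xᵢ≡false i∈X = contradiction (trans (sym (∈⇒lookup i∈X)) Xᵢ≡false) λ ()

lookup-∩ : ∀ {n} (X Y : Subset n) i → lookup (X ∩ Y) i ≡ lookup X i ∧ lookup Y i
lookup-∩ X Y i = VecP.lookup-zipWith _∧_ i X Y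

transpose-matchˡ : ∀ {n} (i x : Fin n) → PermC.transpose i x i ≡ x
transpose-matchˡ i x rewrite dec-true (i ≟ i) refl = refl

transpose-matchʳ : ∀ {n} (i x : Fin n) → PermC.transpose i x x ≡ i
transpose-matchʳ i x with x ≟ i
... | yes x≡i = x≡i
... | no  x≢i rewrite dec-true (x ≟ x) refl = refl

transpose-other : ∀ {n} {i x k : Fin n} → k ≢ i → k ≢ x → PermC.transpose i x k ≡ k
transpose-other {i = i} {x} {k} k≢i k≢x rewrite dec-false (k ≟ i) k≢i | dec-false (k ≟ x) k≢x = refl

module _ {n : ℕ} (inst : Instance n) where
  open Instance inst

  weight : Subset n → Fin n → ℚ
  weight X i = if lookup X i then b i else c i

  weight-nonNeg : ∀ X → NonNeg (weight X)
  weight-nonNeg X i with lookup X i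
  ... | true  = 0≤b i
  ... | false = ℚP.≤-trans (0≤b i) (b≤c i)

  demand : Matching n → Fin n → ℚ
  demand M i = d (σ M ⟨$⟩ʳ i)

  IsCheapest : Matching n → Set
  IsCheapest M = ∀ M′ → Upgrades M′ (red M) → matchingCost inst M ≤ matchingCost inst M′

  swap : Matching n → Fin n → Fin n → Matching n
  swap M i x = matching (Perm.transpose i x ∘ₚ σ M) (red M)

  swap-cost : ∀ M {i x} → i ≢ x →
    matchingCost inst (swap M i x) + (weight (red M) i * demand M i + weight (red M) x * demand M x)
      ≡ matchingCost inst M + (weight (red M) i * demand M x + weight (red M) x * demand M i)
  swap-cost M {i} {x} i≢x = trans (Σᶠ-exchange g h i≢x agree)
    (cong (λ s → matchingCost inst M + s) (cong₂ _+_
      (cong (λ j → w i * d (σ M ⟨$⟩ʳ j)) (transpose-matchˡ i x))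
      (cong (λ j → w x * d (σ M ⟨$⟩ʳ j)) (transpose-matchʳ i x))))
    where
    w : Fin n → ℚ
    w = weight (red M)
    g h : Fin n → ℚ
    g k = w k * demand (swap M i x) k
    h k = w k * demand M k
    agree : ∀ k → k ≢ i → k ≢ x → g k ≡ h k
    agree k k≢i k≢x = cong (λ j → w k * d (σ M ⟨$⟩ʳ j)) (transpose-other k≢i k≢x)

  no-crossing : ∀ M → IsCheapest M → ∀ {i x} →
    weight (red M) x < weight (red M) i → demand M x < demand M i → ⊥
  no-crossing M cheapest {i} {x} wₓ<wᵢ dₓ<dᵢ =
    <⇒≱ (rearrangement-< wₓ<wᵢ dₓ<dᵢ) (+-cancelˡ-≤ (matchingCost inst M) (begin
      matchingCost inst M + (w i * demand M i + w x * demand M x)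
        ≤⟨ ℚP.+-monoˡ-≤ _ (cheapest (swap M i x) refl) ⟩
      matchingCost inst (swap M i x) + (w i * demand M i + w x * demand M x)
        ≡⟨ swap-cost M i≢x ⟩
      matchingCost inst M + (w i * demand M x + w x * demand M i) ∎))
    where
    open ℚP.≤-Reasoning
    w : Fin n → ℚ
    w = weight (red M)
    i≢x : i ≢ x
    i≢x refl = ℚP.<-irrefl refl wₓ<wᵢ

  -- As a cheapest matching has no crossing pair, the two superlevel sets cover all suppliers once they intersect.
  superlevel₂-cheapest : ∀ M → IsCheapest M → ∀ θ η →
    superlevel₂ θ η (weight (red M)) (demand M) ≡ (superlevel η d ℕ.+ superlevel θ (weight (red M))) ℕ.∸ n
  superlevel₂-cheapest M cheapest θ η = begin
    count both                                                  ≡⟨ by-cases (FinP.any? (λ k → both k BoolP.≟ true)) ⟩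
    (count both ℕ.+ count either) ℕ.∸ n                          ≡⟨ cong (ℕ._∸ n) (sym (count-∧-∨ p q)) ⟩
    (count p ℕ.+ count q) ℕ.∸ n                                  ≡⟨ cong (ℕ._∸ n) (ℕP.+-comm (count p) (count q)) ⟩
    (count q ℕ.+ count p) ℕ.∸ n
      ≡⟨ cong (λ s → (s ℕ.+ count p) ℕ.∸ n) (sym (count-permute (atLeast η ∘ d) (σ M))) ⟩
    (superlevel η d ℕ.+ superlevel θ (weight (red M))) ℕ.∸ n     ∎
    where
    open ≡-Reasoning
    p q both either : Fin n → Bool
    p k = atLeast θ (weight (red M) k)
    q k = atLeast η (demand M k)
    both k = p k ∧ q k
    either k = p k ∨ q k
    covered : ∀ {i} → both i ≡ true → ∀ k → either k ≡ true
    covered {i} bothᵢ k with p k in pₖ | q k in qₖ | p i in pᵢ | q i in qᵢ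
    ... | true  | _     | _    | _    = refl
    ... | false | true  | _    | _    = refl
    ... | false | false | true | true = ⊥-elim (no-crossing M cheapest
      (ℚP.<-≤-trans (atLeast-false⁻¹ {θ} pₖ) (atLeast-true⁻¹ {θ} pᵢ))
      (ℚP.<-≤-trans (atLeast-false⁻¹ {η} qₖ) (atLeast-true⁻¹ {η} qᵢ)))
    by-cases : Dec (∃ λ i → both i ≡ true) → count both ≡ (count both ℕ.+ count either) ℕ.∸ n
    by-cases (yes (i , bothᵢ)) =
      sym (trans (cong (λ s → (count both ℕ.+ s) ℕ.∸ n) (count-all (covered bothᵢ))) (ℕP.m+n∸n≡m (count both) n))
    by-cases (no none) = trans none-both (sym (ℕP.m≤n⇒m∸n≡0
      (subst (λ c → c ℕ.+ count either ℕ.≤ n) (sym none-both) (count≤N either))))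
      where
      none-both : count both ≡ 0
      none-both = count-none (λ k → BoolP.¬-not (λ bothₖ → none (k , bothₖ)))

  △⇒xor : ∀ {X Y : Subset n} {i} → _∈△_,_ inst i X Y → lookup X i xor lookup Y i ≡ true
  △⇒xor {X} {Y} {i} (inj₁ (i∈X , i∉Y)) rewrite ∈⇒lookup i∈X | ∉⇒lookup i∉Y = refl
  △⇒xor {X} {Y} {i} (inj₂ (i∉X , i∈Y)) rewrite ∉⇒lookup i∉X | ∈⇒lookup i∈Y = refl

  xor⇒△ : ∀ {X Y : Subset n} {i} → lookup X i xor lookup Y i ≡ true → _∈△_,_ inst i X Y
  xor⇒△ {X} {Y} {i} xor≡true with lookup X i in Xᵢ | lookup Y i in Yᵢ
  ... | true  | false = inj₁ (lookup⇒∈ Xᵢ , lookup⇒∉ Yᵢ)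
  ... | false | true  = inj₂ (lookup⇒∉ Xᵢ , lookup⇒∈ Yᵢ)

  -- θ ∈ (b i , c i]: whether i reaches level θ depends on whether i is upgraded.
  window : ℚ → Fin n → Bool
  window θ i = not (atLeast θ (b i)) ∧ atLeast θ (c i)

  superlevel-window : ∀ X θ →
    superlevel θ (weight X) ℕ.+ count (λ i → lookup X i ∧ window θ i) ≡ count (λ i → atLeast θ (c i))
  superlevel-window X θ = trans (sym (ℕΣ.∑-distrib-+ (𝟙 ∘ atLeast θ ∘ weight X) (λ i → 𝟙 (lookup X i ∧ window θ i))))
    (ℕΣ.sum-cong-≗ (λ i → split i (lookup X i)))
    where
    split : ∀ i x → 𝟙 (atLeast θ (if x then b i else c i)) ℕ.+ 𝟙 (x ∧ window θ i) ≡ 𝟙 (atLeast θ (c i))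
    split i true  = 𝟙-window (atLeast θ (b i)) (atLeast θ (c i)) (atLeast-mono {θ} (b≤c i))
      where
      𝟙-window : ∀ u v → (u ≡ true → v ≡ true) → 𝟙 u ℕ.+ 𝟙 (not u ∧ v) ≡ 𝟙 v
      𝟙-window true  v u⇒v rewrite u⇒v refl = refl
      𝟙-window false v u⇒v = refl
    split i false = ℕP.+-identityʳ _

  module Redistribution {A B A′ B′ : Subset n} (R : IsRedistribution inst A B A′ B′) where

    chain : Fin n → Bool
    chain i = lookup A i xor lookup B i

    ℓ : ℕ
    ℓ = proj₁ R

    enum : Fin ℓ → Fin n
    enum = proj₁ (proj₂ R)

    private
      fields = proj₂ (proj₂ R)

    enum-injective : Injective _≡_ _≡_ enum
    enum-injective = let (inj , _) = fields in inj

    enum-onto : ∀ i → chain i ≡ true → ∃ λ t → enum t ≡ i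
    enum-onto i chainᵢ = let (_ , onto , _) = fields in onto i (xor⇒△ chainᵢ)

    enum-chain : ∀ t → chain (enum t) ≡ true
    enum-chain t = let (_ , _ , on , _) = fields in △⇒xor (on t)

    b-mono : ∀ {s t} → s ≤ᶠ t → b (enum s) ≤ b (enum t)
    b-mono s≤t = let (_ , _ , _ , mono , _) = fields in mono _ _ s≤t

    c-mono : ∀ {s t} → s ≤ᶠ t → c (enum s) ≤ c (enum t)
    c-mono s≤t = let (_ , _ , _ , _ , mono , _) = fields in mono _ _ s≤t

    A′-from : ∀ i → i ∈ A′ → i ∈ (A ∩ B) ⊎ (∃ λ t → enum t ≡ i × toℕ t % 2 ≡ 1)
    A′-from = let (_ , _ , _ , _ , _ , from , _) = fields in from

    A′-to : ∀ i → i ∈ (A ∩ B) ⊎ (∃ λ t → enum t ≡ i × toℕ t % 2 ≡ 1) → i ∈ A′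
    A′-to = let (_ , _ , _ , _ , _ , _ , to , _) = fields in to

    B′-from : ∀ i → i ∈ B′ → i ∈ (A ∩ B) ⊎ (∃ λ t → enum t ≡ i × toℕ t % 2 ≡ 0)
    B′-from = let (_ , _ , _ , _ , _ , _ , _ , from , _) = fields in from

    B′-to : ∀ i → i ∈ (A ∩ B) ⊎ (∃ λ t → enum t ≡ i × toℕ t % 2 ≡ 0) → i ∈ B′
    B′-to = let (_ , _ , _ , _ , _ , _ , _ , _ , to) = fields in to

    chain⇒∉∩ : ∀ {i} → chain i ≡ true → i ∉ A ∩ B
    chain⇒∉∩ {i} chainᵢ i∈A∩B = contradiction (trans (sym (lookup-∩ A B i)) (∈⇒lookup i∈A∩B))
      (λ both → contradiction (trans (sym (xor-∧ (lookup A i) (lookup B i) chainᵢ)) both) λ ())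
      where
      xor-∧ : ∀ x y → x xor y ≡ true → x ∧ y ≡ false
      xor-∧ true  true  ()
      xor-∧ true  false _ = refl
      xor-∧ false y     _ = refl

    off-parity : ∀ {X r} → (∀ i → i ∈ X → i ∈ (A ∩ B) ⊎ (∃ λ t → enum t ≡ i × toℕ t % 2 ≡ r)) →
      ∀ t → toℕ t % 2 ≢ r → enum t ∉ X
    off-parity X-from t wrong-parity enumₜ∈X with X-from (enum t) enumₜ∈X
    ... | inj₁ ∈A∩B              = chain⇒∉∩ (enum-chain t) ∈A∩B
    ... | inj₂ (t′ , eq , parity′) = wrong-parity (subst (λ s → toℕ s % 2 ≡ _) (enum-injective eq) parity′)

    on-chain : ∀ t → lookup A′ (enum t) ≡ isOdd (toℕ t) × lookup B′ (enum t) ≡ isEven (toℕ t)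
    on-chain t with parity (toℕ t)
    ... | inj₁ (even , isEvenₜ , isOddₜ) rewrite isEvenₜ | isOddₜ =
      ∉⇒lookup (off-parity A′-from t (λ odd → contradiction (trans (sym even) odd) λ ())) ,
      ∈⇒lookup (B′-to (enum t) (inj₂ (t , refl , even)))
    ... | inj₂ (odd , isEvenₜ , isOddₜ) rewrite isEvenₜ | isOddₜ =
      ∈⇒lookup (A′-to (enum t) (inj₂ (t , refl , odd))) ,
      ∉⇒lookup (off-parity B′-from t (λ even → contradiction (trans (sym odd) even) λ ()))

    off-chain : ∀ i → chain i ≡ false →
      lookup A′ i ≡ lookup A i × lookup B′ i ≡ lookup A i × lookup B i ≡ lookup A i
    off-chain i chainᵢ with lookup A i in Aᵢ | lookup B i in Bᵢ
    ... | true  | true  = ∈⇒lookup (A′-to i (inj₁ i∈A∩B)) , ∈⇒lookup (B′-to i (inj₁ i∈A∩B)) , refl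
      where
      i∈A∩B : i ∈ A ∩ B
      i∈A∩B = lookup⇒∈ (trans (lookup-∩ A B i) (cong₂ _∧_ Aᵢ Bᵢ))
    ... | false | false = ∉⇒lookup (outside A′-from) , ∉⇒lookup (outside B′-from) , refl
      where
      outside : ∀ {X r} → (∀ j → j ∈ X → j ∈ (A ∩ B) ⊎ (∃ λ t → enum t ≡ j × toℕ t % 2 ≡ r)) → i ∉ X
      outside X-from i∈X with X-from i i∈X
      ... | inj₁ i∈A∩B =
        contradiction (trans (sym (∈⇒lookup i∈A∩B)) (trans (lookup-∩ A B i) (cong₂ _∧_ Aᵢ Bᵢ))) λ ()
      ... | inj₂ (t , refl , _) = contradiction (trans (sym (enum-chain t)) (cong₂ _xor_ Aᵢ Bᵢ)) λ ()

    kept-or-swapped : ∀ i → (lookup A′ i ≡ lookup A i × lookup B′ i ≡ lookup B i)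
                          ⊎ (lookup A′ i ≡ lookup B i × lookup B′ i ≡ lookup A i)
    kept-or-swapped i with chain i in chainᵢ
    ... | false = let (A′ᵢ , B′ᵢ , Bᵢ) = off-chain i chainᵢ in inj₁ (A′ᵢ , trans B′ᵢ (sym Bᵢ))
    ... | true with enum-onto i chainᵢ
    ...   | t , refl = opposites chainᵢ (subst₂ (λ u v → u xor v ≡ true)
                         (sym (proj₁ (on-chain t))) (sym (proj₂ (on-chain t))) (odd-xor-even (toℕ t)))
      where
      odd-xor-even : ∀ m → isOdd m xor isEven m ≡ true
      odd-xor-even zero    = refl
      odd-xor-even (suc m) = trans (BoolP.xor-comm (isEven m) (isOdd m)) (odd-xor-even m)
      opposites : ∀ {x y u v} → x xor y ≡ true → u xor v ≡ true → (u ≡ x × v ≡ y) ⊎ (u ≡ y × v ≡ x)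
      opposites {true}  {false} {true}  {false} _ _ = inj₁ (refl , refl)
      opposites {true}  {false} {false} {true}  _ _ = inj₂ (refl , refl)
      opposites {false} {true}  {true}  {false} _ _ = inj₂ (refl , refl)
      opposites {false} {true}  {false} {true}  _ _ = inj₁ (refl , refl)

    count-pair : ∀ (G : Fin n → Bool → Bool) →
      count (λ i → G i (lookup A i)) ℕ.+ count (λ i → G i (lookup B i))
        ≡ count (λ i → G i (lookup A′ i)) ℕ.+ count (λ i → G i (lookup B′ i))
    count-pair G = count-+-cong pointwise
      where
      pointwise : ∀ i → 𝟙 (G i (lookup A i)) ℕ.+ 𝟙 (G i (lookup B i)) ≡ 𝟙 (G i (lookup A′ i)) ℕ.+ 𝟙 (G i (lookup B′ i))
      pointwise i with kept-or-swapped i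
      ... | inj₁ (A′ᵢ , B′ᵢ) = sym (cong₂ (λ u v → 𝟙 (G i u) ℕ.+ 𝟙 (G i v)) A′ᵢ B′ᵢ)
      ... | inj₂ (A′ᵢ , B′ᵢ) = trans (ℕP.+-comm (𝟙 (G i (lookup A i))) (𝟙 (G i (lookup B i))))
        (sym (cong₂ (λ u v → 𝟙 (G i u) ℕ.+ 𝟙 (G i v)) A′ᵢ B′ᵢ))

    card-+ : ∣ A ∣ ℕ.+ ∣ B ∣ ≡ ∣ A′ ∣ ℕ.+ ∣ B′ ∣
    card-+ = trans (cong₂ ℕ._+_ (∣∣≡count A) (∣∣≡count B))
      (trans (count-pair (λ _ x → x)) (sym (cong₂ ℕ._+_ (∣∣≡count A′) (∣∣≡count B′))))

    superlevel-+ : ∀ θ → superlevel θ (weight A) ℕ.+ superlevel θ (weight B)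
                       ≡ superlevel θ (weight A′) ℕ.+ superlevel θ (weight B′)
    superlevel-+ θ = count-pair (λ i x → atLeast θ (if x then b i else c i))

    window-convex : ∀ θ → Convex (window θ ∘ enum)
    window-convex θ r≤s s≤t windowᵣ windowₜ = window-intro
      (ℚP.≤-<-trans (b-mono s≤t) (proj₁ (window-elim windowₜ))) (ℚP.≤-trans (proj₂ (window-elim windowᵣ)) (c-mono r≤s))
      where
      window-elim : ∀ {i} → window θ i ≡ true → b i < θ × θ ≤ c i
      window-elim {i} w with atLeast θ (b i) in bᵢ | atLeast θ (c i) in cᵢ
      ... | false | true = atLeast-false⁻¹ {θ} bᵢ , atLeast-true⁻¹ {θ} cᵢ
      window-intro : ∀ {i} → b i < θ → θ ≤ c i → window θ i ≡ true
      window-intro {i} b<θ θ≤c =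
        cong₂ (λ u v → not u ∧ v) (dec-false (θ ℚP.≤? b i) (<⇒≱ b<θ)) (dec-true (θ ℚP.≤? c i) θ≤c)

    split-chain : ∀ p → count p ≡ count (λ i → not (chain i) ∧ p i) ℕ.+ count (p ∘ enum)
    split-chain = count-enumeration chain enum enum-injective enum-chain enum-onto

    off-chain-window : ℚ → ℕ
    off-chain-window θ = count (λ i → not (chain i) ∧ (lookup A′ i ∧ window θ i))

    window-A′ : ∀ θ → count (λ i → lookup A′ i ∧ window θ i) ≡ off-chain-window θ ℕ.+ odds (window θ ∘ enum)
    window-A′ θ = trans (split-chain (λ i → lookup A′ i ∧ window θ i))
      (cong (off-chain-window θ ℕ.+_) (count-cong (λ t → cong (_∧ window θ (enum t)) (proj₁ (on-chain t)))))

    window-B′ : ∀ θ → count (λ i → lookup B′ i ∧ window θ i) ≡ off-chain-window θ ℕ.+ evens (window θ ∘ enum)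
    window-B′ θ = trans (split-chain (λ i → lookup B′ i ∧ window θ i))
      (cong₂ ℕ._+_ (count-cong same-off-chain) (count-cong (λ t → cong (_∧ window θ (enum t)) (proj₂ (on-chain t)))))
      where
      same-off-chain : ∀ i → not (chain i) ∧ (lookup B′ i ∧ window θ i) ≡ not (chain i) ∧ (lookup A′ i ∧ window θ i)
      same-off-chain i with chain i in chainᵢ
      ... | true  = refl
      ... | false = let (A′ᵢ , B′ᵢ , _) = off-chain i chainᵢ in cong (_∧ window θ i) (trans B′ᵢ (sym A′ᵢ))

    balanced-superlevels : ∀ θ → Balanced (superlevel θ (weight A′)) (superlevel θ (weight B′))
    balanced-superlevels θ = Balanced-complement same-total
      (subst₂ Balanced (sym (window-A′ θ)) (sym (window-B′ θ))
        (Balanced-+ˡ (off-chain-window θ) (Balanced-sym (convex-parity (window θ ∘ enum) (window-convex θ)))))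
      where
      windowed : Subset n → ℕ
      windowed X = count (λ i → lookup X i ∧ window θ i)
      same-total : windowed A′ ℕ.+ superlevel θ (weight A′) ≡ windowed B′ ℕ.+ superlevel θ (weight B′)
      same-total = trans (ℕP.+-comm (windowed A′) _) (trans (superlevel-window A′ θ)
        (sym (trans (ℕP.+-comm (windowed B′) _) (superlevel-window B′ θ))))

    Agree : Subset n → Set
    Agree X = ∀ i → chain i ≡ false → lookup X i ≡ lookup A i

    agree-A : Agree A
    agree-A _ _ = refl

    agree-B : Agree B
    agree-B i chainᵢ = proj₂ (proj₂ (off-chain i chainᵢ))

    agree-A′ : Agree A′
    agree-A′ i chainᵢ = proj₁ (off-chain i chainᵢ)

    agree-B′ : Agree B′
    agree-B′ i chainᵢ = proj₁ (proj₂ (off-chain i chainᵢ))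

    clean-sub : ∀ {X Y} → Agree X → Agree Y → IsClean inst A B → IsClean inst X Y
    clean-sub {X} {Y} agree-X agree-Y clean i i′ i∈△ i′∈△ = clean i i′ (on-chain-△ i∈△) (on-chain-△ i′∈△)
      where
      on-chain-△ : ∀ {j} → _∈△_,_ inst j X Y → _∈△_,_ inst j A B
      on-chain-△ {j} j∈△ with chain j in chainⱼ
      ... | true  = xor⇒△ chainⱼ
      ... | false = contradiction (trans (sym (△⇒xor j∈△))
        (trans (cong₂ _xor_ (agree-X j chainⱼ) (agree-Y j chainⱼ)) (BoolP.xor-same (lookup A j)))) λ ()

  χ-row : ∀ (M : Matching n) i j → x (χ M) i j + y (χ M) i j ≡ (if ⌊ σ M ⟨$⟩ʳ i ≟ j ⌋ then 1ℚ else 0ℚ)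
  χ-row M i j = split (lookup (red M) i) ⌊ σ M ⟨$⟩ʳ i ≟ j ⌋
    where
    split : ∀ r e → (if r ∧ e then 1ℚ else 0ℚ) + (if r then 0ℚ else (if e then 1ℚ else 0ℚ)) ≡ (if e then 1ℚ else 0ℚ)
    split true  e = ℚP.+-identityʳ (if e then 1ℚ else 0ℚ)
    split false e = ℚP.+-identityˡ (if e then 1ℚ else 0ℚ)

  χ-entries : ∀ (M : Matching n) i j →
    (x (χ M) i j ≡ 0ℚ ⊎ x (χ M) i j ≡ 1ℚ) × (y (χ M) i j ≡ 0ℚ ⊎ y (χ M) i j ≡ 1ℚ)
  χ-entries M i j = entries (lookup (red M) i) ⌊ σ M ⟨$⟩ʳ i ≟ j ⌋
    where
    0∨1 : ℚ → Set
    0∨1 q = q ≡ 0ℚ ⊎ q ≡ 1ℚ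
    entries : ∀ r e → 0∨1 (if r ∧ e then 1ℚ else 0ℚ) × 0∨1 (if r then 0ℚ else (if e then 1ℚ else 0ℚ))
    entries true  true  = inj₂ refl , inj₁ refl
    entries true  false = inj₁ refl , inj₁ refl
    entries false true  = inj₁ refl , inj₂ refl
    entries false false = inj₁ refl , inj₁ refl

  χ-xsum : ∀ (M : Matching n) → Σᶠ (λ i → Σᶠ (λ j → x (χ M) i j)) ≡ ℕ→ℚ (∣ red M ∣)
  χ-xsum M = trans (Σᶠ-cong (λ i → row (lookup (red M) i) (σ M ⟨$⟩ʳ i)))
    (trans (Σᶠ-𝟙 (lookup (red M))) (cong ℕ→ℚ (sym (∣∣≡count (red M)))))
    where
    row : ∀ r a → Σᶠ (λ j → if r ∧ ⌊ a ≟ j ⌋ then 1ℚ else 0ℚ) ≡ ℕ→ℚ (𝟙 r)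
    row true  a = Σᶠ-δ a (λ _ → 1ℚ)
    row false a = Σᶠ-zero {n} (λ _ → refl)

  χ-InP : ∀ {k′} (M : Matching n) → ∣ red M ∣ ℕ.≤ k′ → InP k′ (χ M)
  χ-InP M |red|≤k′ =
    (λ i j → 0≤01 (proj₁ (χ-entries M i j))) , (λ i j → 0≤01 (proj₂ (χ-entries M i j))) ,
    (λ j → trans (Σᶠ-cong (λ i → χ-row M i j))
      (trans (sym (Σᶠ-permute (λ a → if ⌊ a ≟ j ⌋ then 1ℚ else 0ℚ) (σ M))) (Σᶠ-δ′ j))) ,
    (λ i → trans (Σᶠ-cong (χ-row M i)) (Σᶠ-δ (σ M ⟨$⟩ʳ i) (λ _ → 1ℚ))) ,
    subst (_≤ _) (sym (χ-xsum M)) (ℕ→ℚ-mono-≤ |red|≤k′)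
    where
    0≤01 : ∀ {e} → e ≡ 0ℚ ⊎ e ≡ 1ℚ → 0ℚ ≤ e
    0≤01 (inj₁ refl) = ℚP.≤-refl
    0≤01 (inj₂ refl) = ℚP.<⇒≤ (ℚP.positive⁻¹ 1ℚ)

  χ-obj : ∀ (M : Matching n) → obj inst (χ M) ≡ matchingCost inst M
  χ-obj M = Σᶠ-cong (λ i → trans (Σᶠ-cong (λ j → term (lookup (red M) i) ⌊ σ M ⟨$⟩ʳ i ≟ j ⌋ (b i) (c i) (d j)))
    (Σᶠ-δ (σ M ⟨$⟩ʳ i) (λ j → (if lookup (red M) i then b i else c i) * d j)))
    where
    open ℚ-Solver
    term : ∀ r e β γ δ → β * δ * (if r ∧ e then 1ℚ else 0ℚ) + γ * δ * (if r then 0ℚ else (if e then 1ℚ else 0ℚ))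
                       ≡ (if e then (if r then β else γ) * δ else 0ℚ)
    term true  true  β γ δ = solve 3 (λ β γ δ → β :* δ :* con 1ℚ :+ γ :* δ :* con 0ℚ := β :* δ) refl β γ δ
    term true  false β γ δ = solve 3 (λ β γ δ → β :* δ :* con 0ℚ :+ γ :* δ :* con 0ℚ := con 0ℚ) refl β γ δ
    term false true  β γ δ = solve 3 (λ β γ δ → β :* δ :* con 0ℚ :+ γ :* δ :* con 1ℚ := γ :* δ) refl β γ δ
    term false false β γ δ = solve 3 (λ β γ δ → β :* δ :* con 0ℚ :+ γ :* δ :* con 0ℚ := con 0ℚ) refl β γ δ

  InP-entry≤1 : ∀ {k′} (p : Point n) → InP k′ p → ∀ i j → x p i j ≤ 1ℚ × y p i j ≤ 1ℚ
  InP-entry≤1 p (x≥0 , y≥0 , _ , row , _) i j =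
    ℚP.≤-trans (p≤p+q (y≥0 i j)) entry≤row ,
    ℚP.≤-trans (subst (y p i j ≤_) (ℚP.+-comm (y p i j) (x p i j)) (p≤p+q (x≥0 i j))) entry≤row
    where
    entry≤row : x p i j + y p i j ≤ 1ℚ
    entry≤row = subst (x p i j + y p i j ≤_) (row i)
      (Σᶠ-term (λ j′ → x p i j′ + y p i j′) (λ j′ → ℚP.+-mono-≤ (x≥0 i j′) (y≥0 i j′) ) j)

  χ-vertex : ∀ {k′} (M : Matching n) → InP k′ (χ M) → IsVertex k′ (χ M)
  χ-vertex {k′} M χ∈P = χ∈P , λ q r t q∈P r∈P t>0 t<1 χ≐comb i j →
    convex-01 t>0 t<1 (proj₁ q∈P i j) (proj₁ (≤1 q q∈P i j)) (proj₁ r∈P i j) (proj₁ (≤1 r r∈P i j))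
      (proj₁ (χ-entries M i j)) (proj₁ (χ≐comb i j)) ,
    convex-01 t>0 t<1 (proj₁ (proj₂ q∈P) i j) (proj₂ (≤1 q q∈P i j)) (proj₁ (proj₂ r∈P) i j) (proj₂ (≤1 r r∈P i j))
      (proj₂ (χ-entries M i j)) (proj₂ (χ≐comb i j))
    where
    ≤1 = InP-entry≤1 {k′}

  xsum : Point n → ℚ
  xsum p = Σᶠ (λ i → Σᶠ (λ j → x p i j))

  Σᶠ²-linear : ∀ (s t : ℚ) (f g : Fin n → Fin n → ℚ) →
    Σᶠ (λ i → Σᶠ (λ j → s * f i j + t * g i j)) ≡ s * Σᶠ (λ i → Σᶠ (f i)) + t * Σᶠ (λ i → Σᶠ (g i))
  Σᶠ²-linear s t f g =
    trans (Σᶠ-cong (λ i → Σᶠ-linear s t (f i) (g i))) (Σᶠ-linear s t (λ i → Σᶠ (f i)) (λ i → Σᶠ (g i)))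

  xsum-comb : ∀ t P Q → xsum (comb t P Q) ≡ t * xsum P + (1ℚ - t) * xsum Q
  xsum-comb t P Q = Σᶠ²-linear t (1ℚ - t) (x P) (x Q)

  obj-comb : ∀ t P Q → obj inst (comb t P Q) ≡ t * obj inst P + (1ℚ - t) * obj inst Q
  obj-comb t P Q =
    trans (Σᶠ-cong (λ i → Σᶠ-cong (λ j → regroup (b i * d j) (c i * d j) (x P i j) (x Q i j) (y P i j) (y Q i j))))
    (Σᶠ²-linear t (1ℚ - t) (term P) (term Q))
    where
    open ℚ-Solver
    term : Point n → Fin n → Fin n → ℚ
    term p i j = b i * d j * x p i j + c i * d j * y p i j
    regroup : ∀ β γ u u′ v v′ → β * (t * u + (1ℚ - t) * u′) + γ * (t * v + (1ℚ - t) * v′)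
                              ≡ t * (β * u + γ * v) + (1ℚ - t) * (β * u′ + γ * v′)
    regroup = solve 7 (λ t β γ u u′ v v′ → β :* (t :* u :+ (con 1ℚ :- t) :* u′) :+ γ :* (t :* v :+ (con 1ℚ :- t) :* v′)
                                         := t :* (β :* u :+ γ :* v) :+ (con 1ℚ :- t) :* (β :* u′ :+ γ :* v′)) refl t

  comb-InP : ∀ {kP kQ k′} t P Q → 0ℚ ≤ t → 0ℚ ≤ 1ℚ - t → InP kP P → InP kQ Q →
    t * xsum P + (1ℚ - t) * xsum Q ≤ ℕ→ℚ k′ → InP k′ (comb t P Q)
  comb-InP t P Q t≥0 1-t≥0 (xP≥0 , yP≥0 , colP , rowP , _) (xQ≥0 , yQ≥0 , colQ , rowQ , _) xsum≤ =
    (λ i j → nonNeg (xP≥0 i j) (xQ≥0 i j)) , (λ i j → nonNeg (yP≥0 i j) (yQ≥0 i j)) ,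
    (λ j → unit-sum (λ i → x P i j) (λ i → y P i j) (λ i → x Q i j) (λ i → y Q i j) (colP j) (colQ j)) ,
    (λ i → unit-sum (x P i) (y P i) (x Q i) (y Q i) (rowP i) (rowQ i)) ,
    subst (_≤ _) (sym (xsum-comb t P Q)) xsum≤
    where
    open ℚ-Solver
    nonNeg : ∀ {u v} → 0ℚ ≤ u → 0ℚ ≤ v → 0ℚ ≤ t * u + (1ℚ - t) * v
    nonNeg u≥0 v≥0 = ℚP.≤-trans (ℚP.≤-reflexive (sym (ℚP.+-identityʳ 0ℚ)))
      (ℚP.+-mono-≤ (*-nonNeg t≥0 u≥0) (*-nonNeg 1-t≥0 v≥0))
    unit-sum : (u v u′ v′ : Fin n → ℚ) → Σᶠ (λ i → u i + v i) ≡ 1ℚ → Σᶠ (λ i → u′ i + v′ i) ≡ 1ℚ →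
      Σᶠ (λ i → (t * u i + (1ℚ - t) * u′ i) + (t * v i + (1ℚ - t) * v′ i)) ≡ 1ℚ
    unit-sum u v u′ v′ sum≡1 sum′≡1 = begin
      Σᶠ (λ i → (t * u i + (1ℚ - t) * u′ i) + (t * v i + (1ℚ - t) * v′ i))
        ≡⟨ Σᶠ-cong (λ i → solve 5 (λ t u u′ v v′ → (t :* u :+ (con 1ℚ :- t) :* u′) :+ (t :* v :+ (con 1ℚ :- t) :* v′)
                                             := t :* (u :+ v) :+ (con 1ℚ :- t) :* (u′ :+ v′))
                           refl t (u i) (u′ i) (v i) (v′ i)) ⟩
      Σᶠ (λ i → t * (u i + v i) + (1ℚ - t) * (u′ i + v′ i))
        ≡⟨ Σᶠ-linear t (1ℚ - t) (λ i → u i + v i) (λ i → u′ i + v′ i) ⟩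
      t * Σᶠ (λ i → u i + v i) + (1ℚ - t) * Σᶠ (λ i → u′ i + v′ i)
        ≡⟨ cong₂ (λ p q → t * p + (1ℚ - t) * q) sum≡1 sum′≡1 ⟩
      t * 1ℚ + (1ℚ - t) * 1ℚ
        ≡⟨ solve 1 (λ t → t :* con 1ℚ :+ (con 1ℚ :- t) :* con 1ℚ := con 1ℚ) refl t ⟩
      1ℚ ∎
      where open ≡-Reasoning

  module _ (M : Subset n → Matching n) (minM : ∀ X → IsMinMatching inst X (M X)) where
    open WithChoice inst M using (cost; f; IsOptimalPair)

    cost≡ : ∀ X → cost X ≡ Σᶠ (λ i → weight X i * demand (M X) i)
    cost≡ X = cong (λ Y → Σᶠ (λ i → weight Y i * demand (M X) i)) (proj₁ (minM X))

    superlevel₂-min : ∀ X θ η →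
      superlevel₂ θ η (weight X) (demand (M X)) ≡ (superlevel η d ℕ.+ superlevel θ (weight X)) ℕ.∸ n
    superlevel₂-min X θ η = subst
      (λ Y → superlevel₂ θ η (weight Y) (demand (M X)) ≡ (superlevel η d ℕ.+ superlevel θ (weight Y)) ℕ.∸ n)
      (proj₁ (minM X))
      (superlevel₂-cheapest (M X) (λ M′ upg → proj₂ (minM X) M′ (trans upg (proj₁ (minM X)))) θ η)

    cost-+-≤ : ∀ A B A′ B′ →
      (∀ θ → superlevel θ (weight A) ℕ.+ superlevel θ (weight B)
           ≡ superlevel θ (weight A′) ℕ.+ superlevel θ (weight B′)) →
      (∀ θ → Balanced (superlevel θ (weight A′)) (superlevel θ (weight B′))) →
      cost A′ + cost B′ ≤ cost A + cost B
    cost-+-≤ A B A′ B′ same-levels balanced = subst₂ _≤_ (cost-pair A′ B′) (cost-pair A B)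
      (Σᶠ-*-≤-bySuperlevels (wd-nonNeg A B) (dd-nonNeg A B) (wd-nonNeg A′ B′) (dd-nonNeg A′ B′) levels)
      where
      ws ds : Subset n → Subset n → Fin (n ℕ.+ n) → ℚ
      ws X Y = weight X ++ weight Y
      ds X Y = demand (M X) ++ demand (M Y)
      wd-nonNeg : ∀ X Y → NonNeg (ws X Y)
      wd-nonNeg X Y = ++-nonNeg (weight-nonNeg X) (weight-nonNeg Y)
      dd-nonNeg : ∀ X Y → NonNeg (ds X Y)
      dd-nonNeg X Y = ++-nonNeg (λ i → 0≤d (σ (M X) ⟨$⟩ʳ i)) (λ i → 0≤d (σ (M Y) ⟨$⟩ʳ i))
      cost-pair : ∀ X Y → Σᶠ (λ k → ws X Y k * ds X Y k) ≡ cost X + cost Y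
      cost-pair X Y = trans (Σᶠ-++-* (weight X) (demand (M X)) (weight Y) (demand (M Y)))
        (sym (cong₂ _+_ (cost≡ X) (cost≡ Y)))
      pair-level : ∀ X Y θ η → superlevel₂ θ η (ws X Y) (ds X Y) ≡
        (superlevel η d ℕ.+ superlevel θ (weight X)) ℕ.∸ n ℕ.+ ((superlevel η d ℕ.+ superlevel θ (weight Y)) ℕ.∸ n)
      pair-level X Y θ η = trans (superlevel₂-++ θ η (weight X) (demand (M X)) (weight Y) (demand (M Y)))
        (cong₂ ℕ._+_ (superlevel₂-min X θ η) (superlevel₂-min Y θ η))
      levels : ∀ θ η → 0ℚ < θ → 0ℚ < η → superlevel₂ θ η (ws A′ B′) (ds A′ B′) ℕ.≤ superlevel₂ θ η (ws A B) (ds A B)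
      levels θ η _ _ = subst₂ ℕ._≤_ (sym (pair-level A′ B′ θ η)) (sym (pair-level A B θ η))
        (∸-balanced-≤ n shifted-sums (Balanced-+ˡ e (balanced θ)))
        where
        e = superlevel η d
        sA sB sA′ sB′ : ℕ
        sA = superlevel θ (weight A)
        sB = superlevel θ (weight B)
        sA′ = superlevel θ (weight A′)
        sB′ = superlevel θ (weight B′)
        shuffle : ∀ x y → e ℕ.+ x ℕ.+ (e ℕ.+ y) ≡ x ℕ.+ y ℕ.+ (e ℕ.+ e)
        shuffle = solve 3 (λ e x y → e :+ x :+ (e :+ y) := x :+ y :+ (e :+ e)) refl e
          where open ℕ-Solver
        shifted-sums : e ℕ.+ sA ℕ.+ (e ℕ.+ sB) ≡ e ℕ.+ sA′ ℕ.+ (e ℕ.+ sB′)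
        shifted-sums = trans (shuffle sA sB) (trans (cong (ℕ._+ (e ℕ.+ e)) (same-levels θ)) (sym (shuffle sA′ sB′)))

    χM-InP : ∀ X {k′} → ∣ X ∣ ℕ.≤ k′ → InP k′ (χ (M X))
    χM-InP X |X|≤k′ = χ-InP (M X) (subst (λ Y → ∣ Y ∣ ℕ.≤ _) (sym (proj₁ (minM X))) |X|≤k′)

    χM-xsum : ∀ X → xsum (χ (M X)) ≡ ℕ→ℚ (∣ X ∣)
    χM-xsum X = trans (χ-xsum (M X)) (cong (λ Y → ℕ→ℚ (∣ Y ∣)) (proj₁ (minM X)))

    -- f X Y carries the factor 1 / (|Y| - |X|), written exactly as in its definition.
    scale : ∀ (X Y : Subset n) → ∣ X ∣ ℕ.< ∣ Y ∣ → ℚ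
    scale X Y lt = let instance _ = ℕ.>-nonZero (ℕP.m<n⇒0<n∸m lt) in ℤ.+ 1 / (∣ Y ∣ ℕ.∸ ∣ X ∣)

    scale-inverse : ∀ (X Y : Subset n) lt → scale X Y lt * (ℕ→ℚ (∣ Y ∣) - ℕ→ℚ (∣ X ∣)) ≡ 1ℚ
    scale-inverse X Y lt = let instance _ = ℕ.>-nonZero (ℕP.m<n⇒0<n∸m lt) in
      trans (cong (scale X Y lt *_) (sym (ℕ→ℚ-∸ (ℕP.<⇒≤ lt)))) (1/n*n≡1 (∣ Y ∣ ℕ.∸ ∣ X ∣))

    scale-nonNeg : ∀ (X Y : Subset n) lt → 0ℚ ≤ scale X Y lt
    scale-nonNeg X Y lt = let instance _ = ℕ.>-nonZero (ℕP.m<n⇒0<n∸m lt) in 0≤1/n (∣ Y ∣ ℕ.∸ ∣ X ∣)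

    interpolation-point : ∀ X Y (|X|<k : ∣ X ∣ ℕ.< k) (k<|Y| : k ℕ.< ∣ Y ∣) →
      ∃ λ p → InP k p × obj inst p ≡ f X Y (ℕP.<-trans |X|<k k<|Y|)
    interpolation-point X Y |X|<k k<|Y| = comb t (χ (M X)) (χ (M Y)) ,
      comb-InP {∣ X ∣} {∣ Y ∣} {k} t _ _ t≥0 1-t≥0 (χM-InP X ℕP.≤-refl) (χM-InP Y ℕP.≤-refl)
        (ℚP.≤-reflexive (trans (cong₂ (λ u v → t * u + (1ℚ - t) * v) (χM-xsum X) (χM-xsum Y)) weighted-mean)) ,
      trans (obj-comb t _ _) (trans (cong₂ (λ u v → t * u + (1ℚ - t) * v) (χ-obj (M X)) (χ-obj (M Y)))
        (weighted-value (cost X) (cost Y)))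
      where
      lt = ℕP.<-trans |X|<k k<|Y|
      ι = scale X Y lt
      ι-inv = scale-inverse X Y lt
      ι≥0 = scale-nonNeg X Y lt
      t = (ℕ→ℚ (∣ Y ∣) - ℕ→ℚ k) * ι
      open Weights (ℕ→ℚ (∣ X ∣)) (ℕ→ℚ (∣ Y ∣)) (ℕ→ℚ k) ι ι-inv
      t≥0 : 0ℚ ≤ t
      t≥0 = *-nonNeg (p≤q⇒0≤q-p (ℕ→ℚ-mono-≤ (ℕP.<⇒≤ k<|Y|))) ι≥0
      1-t≥0 : 0ℚ ≤ 1ℚ - t
      1-t≥0 = subst (0ℚ ≤_) (sym weight-complement) (*-nonNeg (p≤q⇒0≤q-p (ℕ→ℚ-mono-≤ (ℕP.<⇒≤ |X|<k))) ι≥0)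

    BelowChord : (A B X : Subset n) → Set
    BelowChord A B X = Below (ℕ→ℚ (∣ A ∣)) (ℕ→ℚ (∣ B ∣)) (cost A) (cost B) (ℕ→ℚ (∣ X ∣)) (cost X)

    IsLPOptimum-≤ : ∀ {v₀ v p} → IsLPOptimum inst v₀ → InP k p → obj inst p ≡ v → v ≤ v₀ → IsLPOptimum inst v
    IsLPOptimum-≤ (_ , v₀-least) p∈P obj≡v v≤v₀ =
      (_ , p∈P , obj≡v) , λ q q∈P → ℚP.≤-trans v≤v₀ (v₀-least q q∈P)

    chord-vertex : ∀ {A B X} → IsOptimalPair A B → ∣ X ∣ ≡ k → BelowChord A B X → IsOptimalVertex inst (χ (M X))
    chord-vertex {A} {B} {X} (|A|<k , k<|B| , _ , v-least) |X|≡k X-below =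
      χ-vertex {k} (M X) (χM-InP X (ℕP.≤-reflexive |X|≡k)) ,
      λ q q∈P → ℚP.≤-trans (subst (_≤ _) (sym (χ-obj (M X)))
        (below-value (scale A B lt) (scale-inverse A B lt) (scale-nonNeg A B lt)
          (subst (λ m → Below (ℕ→ℚ (∣ A ∣)) (ℕ→ℚ (∣ B ∣)) (cost A) (cost B) (ℕ→ℚ m) (cost X)) |X|≡k X-below)))
        (v-least q q∈P)
      where
      lt = ℕP.<-trans |A|<k k<|B|

    chord-pair : ∀ {A B X Y} → IsOptimalPair A B → (|X|<k : ∣ X ∣ ℕ.< k) → (k<|Y| : k ℕ.< ∣ Y ∣) →
      BelowChord A B X → BelowChord A B Y → IsOptimalPair X Y
    chord-pair {A} {B} {X} {Y} (|A|<k , k<|B| , optimum) |X|<k k<|Y| belowX belowY =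
      let (_ , p∈P , obj≡f) = interpolation-point X Y |X|<k k<|Y| in
      |X|<k , k<|Y| , IsLPOptimum-≤ optimum p∈P obj≡f
        (below-interpolate (scale A B ltAB) (scale X Y ltXY)
          (scale-inverse A B ltAB) (scale-nonNeg A B ltAB) (scale-inverse X Y ltXY) (scale-nonNeg X Y ltXY)
          (ℕ→ℚ-mono-≤ (ℕP.<⇒≤ |X|<k)) (ℕ→ℚ-mono-≤ (ℕP.<⇒≤ k<|Y|)) belowX belowY)
      where
      ltAB = ℕP.<-trans |A|<k k<|B|
      ltXY = ℕP.<-trans |X|<k k<|Y|

    redistribution-below : ∀ {A B A′ B′} → IsRedistribution inst A B A′ B′ → ∣ A ∣ ℕ.≤ ∣ B ∣ →
      BelowChord A B A′ ⊎ BelowChord A B B′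
    redistribution-below {A} {B} {A′} {B′} R |A|≤|B| = below-split
      (trans (sym (ℕ→ℚ-+ ∣ A′ ∣ ∣ B′ ∣)) (trans (cong ℕ→ℚ (sym card-+)) (ℕ→ℚ-+ ∣ A ∣ ∣ B ∣)))
      (ℕ→ℚ-mono-≤ |A|≤|B|) (cost-+-≤ A B A′ B′ superlevel-+ balanced-superlevels)
      where open Redistribution R

    around-k : ∀ {A B X} → IsOptimalPair A B → BelowChord A B X →
      IsOptimalVertex inst (χ (M X)) ⊎ IsOptimalPair X B ⊎ IsOptimalPair A X
    around-k {A} {B} {X} optimal@(|A|<k , k<|B| , _) X-below = by-position (ℕP.<-cmp ∣ X ∣ k)
      where
      by-position : Tri (∣ X ∣ ℕ.< k) (∣ X ∣ ≡ k) (k ℕ.< ∣ X ∣) →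
        IsOptimalVertex inst (χ (M X)) ⊎ IsOptimalPair X B ⊎ IsOptimalPair A X
      by-position (tri< |X|<k _ _) = inj₂ (inj₁ (chord-pair optimal |X|<k k<|B| X-below (below-endpointʳ _ _ _ _)))
      by-position (tri≈ _ |X|≡k _) = inj₁ (chord-vertex optimal |X|≡k X-below)
      by-position (tri> _ _ k<|X|) = inj₂ (inj₂ (chord-pair optimal |A|<k k<|X| (below-endpointˡ _ _ _ _) X-below))

corollary3p10 :
  ∀ {n : ℕ} (inst : Instance n) (M : Subset n → Matching n) →
  (∀ X → IsMinMatching inst X (M X)) →
  ∀ (A B A′ B′ : Subset n) →
  IsClean inst A B →
  WithChoice.IsOptimalPair inst M A B →
  IsRedistribution inst A B A′ B′ →
  (IsOptimalVertex inst (χ (M A′)) ⊎ IsOptimalVertex inst (χ (M B′)))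
  ⊎ ((IsClean inst A B′ × WithChoice.IsOptimalPair inst M A B′)
    ⊎ (IsClean inst A A′ × WithChoice.IsOptimalPair inst M A A′)
    ⊎ (IsClean inst A′ B × WithChoice.IsOptimalPair inst M A′ B)
    ⊎ (IsClean inst B′ B × WithChoice.IsOptimalPair inst M B′ B))
corollary3p10 inst M minM A B A′ B′ clean optimal@(|A|<k , k<|B| , _) R =
  [ place-A′ ∘ around-k inst M minM optimal , place-B′ ∘ around-k inst M minM optimal ]′
    (redistribution-below inst M minM R (ℕP.<⇒≤ (ℕP.<-trans |A|<k k<|B|)))
  where
  open WithChoice inst M using (IsOptimalPair)
  open Redistribution inst R using (clean-sub; agree-A; agree-B; agree-A′; agree-B′)
  place-A′ : IsOptimalVertex inst (χ (M A′)) ⊎ IsOptimalPair A′ B ⊎ IsOptimalPair A A′ → _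
  place-A′ (inj₁ vertex)      = inj₁ (inj₁ vertex)
  place-A′ (inj₂ (inj₁ pair)) = inj₂ (inj₂ (inj₂ (inj₁ (clean-sub agree-A′ agree-B clean , pair))))
  place-A′ (inj₂ (inj₂ pair)) = inj₂ (inj₂ (inj₁ (clean-sub agree-A agree-A′ clean , pair)))
  place-B′ : IsOptimalVertex inst (χ (M B′)) ⊎ IsOptimalPair B′ B ⊎ IsOptimalPair A B′ → _
  place-B′ (inj₁ vertex)      = inj₁ (inj₂ vertex)
  place-B′ (inj₂ (inj₁ pair)) = inj₂ (inj₂ (inj₂ (inj₂ (clean-sub agree-B′ agree-B clean , pair))))
  place-B′ (inj₂ (inj₂ pair)) = inj₂ (inj₁ (clean-sub agree-A agree-B′ clean , pair))
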